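{- Let $G$ be a connected block graph with blocks $B_1, B_2, \ldots, B_t$ and $|V(G)|=n$. Then $$SW_3(G) = \frac{n-2}{2}\, W(G) + \frac 12 \sum_{i=1}^t N_3(G \setminus B_i).$$
   Context: A block of a graph is a maximal connected induced subgraph without cut vertices; a block graph is a graph in which every block is a clique. For a block $B_i$, $G\setminus B_i$ denotes the graph obtained from $G$ by deleting all edges of $B_i$ (keeping all vertices). For a graph $H$ with connected components $H_1,\ldots,H_p$ and $n(H_j)=|V(H_j)|$, define $N_3(H)=\sum_{\{i,j,k\}\subseteq\{1,\ldots,p\}} n(H_i)\,n(H_j)\,n(H_k)$ if $p\ge3$, and $N_3(H)=0$ if $p<3$. $W(G)=\sum_{\{u,v\}\subseteq V(G)} d(u,v)$ is the Wiener index (shortest-path distances, unordered pairs of distinct vertices). The Steiner distance $d(S)$ of $S\subseteq V(G)$ is the minimum number of edges of a connected subgraph of $G$ containing $S$, and $SW_3(G)=\sum_{S\subseteq V(G),\,|S|=3} d(S)$. -}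

module Defs where

open import Data.Nat using (ℕ; zero; suc; _+_; _*_; _≤_; _<ᵇ_)
open import Data.Fin using (Fin; toℕ; _≟_)
open import Data.Bool using (Bool; true; false; _∧_; not; if_then_else_)
open import Data.Product using (Σ; _×_; ∃; ∃-syntax)
open import Relation.Binary.PropositionalEquality using (_≡_; _≢_)
open import Relation.Nullary using (¬_; does)
open import Function.Bundles using (_⇔_)

sumFin : (n : ℕ) → (Fin n → ℕ) → ℕ
sumFin zero    f = 0
sumFin (suc n) f = f Data.Fin.zero + sumFin n (λ i → f (Data.Fin.suc i))

_<F_ : {n : ℕ} → Fin n → Fin n → Bool
i <F j = toℕ i <ᵇ toℕ j

record Graph (n : ℕ) : Set where
  field
    adj    : Fin n → Fin n → Bool
    sym    : ∀ u v → adj u v ≡ adj v u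
    irrefl : ∀ u → adj u u ≡ false
open Graph public

VSet : ℕ → Set
VSet n = Fin n → Bool

ERel : ℕ → Set
ERel n = Fin n → Fin n → Bool

data Walk {n : ℕ} (E : ERel n) : Fin n → Fin n → ℕ → Set where
  here : ∀ {u} → Walk E u u 0
  step : ∀ {u w v k} → E u w ≡ true → Walk E w v k → Walk E u v (suc k)

Reach : {n : ℕ} → ERel n → Fin n → Fin n → Set
Reach E u v = ∃[ k ] Walk E u v k

restrict : {n : ℕ} → ERel n → VSet n → ERel n
restrict E S u v = E u v ∧ S u ∧ S v

ConnectedOn : {n : ℕ} → ERel n → VSet n → Set
ConnectedOn {n} E S = ∀ (u v : Fin n) → S u ≡ true → S v ≡ true → Reach (restrict E S) u v

Connected : {n : ℕ} → Graph n → Set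
Connected {n} G = ∀ (u v : Fin n) → Reach (adj G) u v

removeV : {n : ℕ} → VSet n → Fin n → VSet n
removeV S x u = S u ∧ not (does (u ≟ x))

_⊆V_ : {n : ℕ} → VSet n → VSet n → Set
A ⊆V B = ∀ u → A u ≡ true → B u ≡ true

-- Induced subgraph G[B] is a nonempty connected graph without cut vertices
-- (for a connected graph, x is a cut vertex iff deleting x disconnects it).
Nonseparable : {n : ℕ} → Graph n → VSet n → Set
Nonseparable G B =
  (∃[ u ] B u ≡ true)
  × ConnectedOn (adj G) B
  × (∀ x → B x ≡ true → ConnectedOn (adj G) (removeV B x))

IsBlock : {n : ℕ} → Graph n → VSet n → Set
IsBlock G B = Nonseparable G B × (∀ B' → B ⊆V B' → Nonseparable G B' → B' ⊆V B)

IsClique : {n : ℕ} → Graph n → VSet n → Set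
IsClique G B = ∀ u v → B u ≡ true → B v ≡ true → u ≢ v → adj G u v ≡ true

IsBlockGraph : {n : ℕ} → Graph n → Set
IsBlockGraph G = ∀ B → IsBlock G B → IsClique G B

BlockEnumeration : {n : ℕ} → Graph n → (t : ℕ) → (Fin t → VSet n) → Set
BlockEnumeration G t B =
  (∀ i → IsBlock G (B i))
  × (∀ C → IsBlock G C → ∃[ i ] (∀ u → B i u ≡ C u))
  × (∀ i j → (∀ u → B i u ≡ B j u) → i ≡ j)

-- G \ B : delete all edges of the (induced) block B, keep all vertices.
deleteBlockEdges : {n : ℕ} → Graph n → VSet n → ERel n
deleteBlockEdges G B u v = adj G u v ∧ not (B u ∧ B v)

IsDistance : {n : ℕ} → Graph n → (Fin n → Fin n → ℕ) → Set
IsDistance G d = ∀ u v → Walk (adj G) u v (d u v) × (∀ m → Walk (adj G) u v m → d u v ≤ m)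

wiener : (n : ℕ) → (Fin n → Fin n → ℕ) → ℕ
wiener n d = sumFin n λ u → sumFin n λ v → if u <F v then d u v else 0

edgeCount : (n : ℕ) → ERel n → ℕ
edgeCount n Es = sumFin n λ u → sumFin n λ v → if u <F v ∧ Es u v then 1 else 0

IsConnectedSubgraph : {n : ℕ} → Graph n → VSet n → ERel n → Set
IsConnectedSubgraph G Vs Es =
  (∀ u v → Es u v ≡ true → (adj G u v ≡ true) × (Vs u ≡ true) × (Vs v ≡ true))
  × (∀ u v → Es u v ≡ Es v u)
  × ConnectedOn Es Vs

IsSteinerDist : {n : ℕ} → Graph n → Fin n → Fin n → Fin n → ℕ → Set
IsSteinerDist {n} G a b c k =
  (∃[ Vs ] ∃[ Es ] (IsConnectedSubgraph G Vs Es × Vs a ≡ true × Vs b ≡ true × Vs c ≡ true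
                    × edgeCount n Es ≡ k))
  × (∀ Vs Es → IsConnectedSubgraph G Vs Es → Vs a ≡ true → Vs b ≡ true → Vs c ≡ true
       → k ≤ edgeCount n Es)

IsSteinerDist3 : {n : ℕ} → Graph n → (Fin n → Fin n → Fin n → ℕ) → Set
IsSteinerDist3 G sd = ∀ a b c → a <F b ≡ true → b <F c ≡ true → IsSteinerDist G a b c (sd a b c)

steinerWiener3 : (n : ℕ) → (Fin n → Fin n → Fin n → ℕ) → ℕ
steinerWiener3 n sd = sumFin n λ a → sumFin n λ b → sumFin n λ c →
  if a <F b ∧ b <F c then sd a b c else 0

IsComponentLabeling : {n : ℕ} → ERel n → (p : ℕ) → (Fin n → Fin p) → Set
IsComponentLabeling {n} E p c =
  (∀ j → ∃[ u ] c u ≡ j) × (∀ u v → (c u ≡ c v) ⇔ Reach E u v)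

compSize : (n p : ℕ) → (Fin n → Fin p) → Fin p → ℕ
compSize n p c j = sumFin n λ u → if does (c u ≟ j) then 1 else 0

N3 : (n p : ℕ) → (Fin n → Fin p) → ℕ
N3 n p c = sumFin p λ i → sumFin p λ j → sumFin p λ k →
  if i <F j ∧ j <F k then compSize n p c i * compSize n p c j * compSize n p c k else 0

-- In a block graph every edge lies in exactly one block, and two vertices of a block B lie in
-- different components of G ∖ B.  A geodesic therefore crosses each block at most once (two
-- crossings of the clique B could be short-cut by one edge of B), so d(u, v) is the number of
-- blocks B for which u and v lie in different components of G ∖ B.  Likewise a connected subgraph
-- containing a, b, c must use at least one, resp. two, edges of B when a, b, c meet two, resp.
-- three, components of G ∖ B, and the union of the geodesics from a to b and from a to c attains
-- this.  Hence B contributes [ab] + [ac] + [bc] + [abc] to 2 d(a, b, c), where [xy] says that x, y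
-- are separated and [abc] that a, b, c are pairwise separated.  Summed over all triples, each pair
-- occurs in n − 2 of them, giving (n − 2) W(G), and the [abc] terms add up to N₃(G ∖ B).

module Submission where

open import Defs
open import Data.Nat using (ℕ; zero; suc; _+_; _*_; _∸_; _≤_; _<_; z≤n; s≤s; s≤s⁻¹)
open import Data.Nat.Properties hiding (_≟_; ≡ᵇ⇒≡)
open import Data.Nat.Induction using (<-rec)
open import Data.Nat.Tactic.RingSolver using (solve-∀)
open import Data.Fin as F using (Fin; toℕ)
open import Data.Fin.Properties using (_≟_; toℕ-injective; any?)
open import Data.Bool using (Bool; true; false; _∧_; _∨_; not; if_then_else_)
import Data.Bool.Properties as Boolₚ
open import Data.Product using (_×_; _,_; proj₁; proj₂; ∃-syntax)
open import Data.Sum using (_⊎_; inj₁; inj₂)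
open import Data.Empty using (⊥; ⊥-elim)
open import Relation.Binary.PropositionalEquality
  using (_≡_; _≢_; _≗_; refl; trans; cong; cong₂; subst; subst₂; module ≡-Reasoning)
  renaming (sym to ≡-sym)
open import Relation.Nullary using (¬_; does; yes; no)
open import Relation.Binary.Definitions using (tri<; tri≈; tri>)
open import Function.Bundles using (Equivalence)

𝟙 : Bool → ℕ
𝟙 true  = 1
𝟙 false = 0

_≡ᵇ_ : ∀ {n} → Fin n → Fin n → Bool
x ≡ᵇ y = does (x ≟ y)

≡ᵇ-refl : ∀ {n} (x : Fin n) → (x ≡ᵇ x) ≡ true
≡ᵇ-refl x with x ≟ x
... | yes _ = refl
... | no x≢x = ⊥-elim (x≢x refl)

≡ᵇ⇒≡ : ∀ {n} {x y : Fin n} → (x ≡ᵇ y) ≡ true → x ≡ y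
≡ᵇ⇒≡ {x = x} {y} e with x ≟ y
... | yes x≡y = x≡y

≢⇒≡ᵇ-false : ∀ {n} {x y : Fin n} → x ≢ y → (x ≡ᵇ y) ≡ false
≢⇒≡ᵇ-false {x = x} {y} x≢y with x ≟ y
... | yes x≡y = ⊥-elim (x≢y x≡y)
... | no _ = refl

≡ᵇ-false⇒≢ : ∀ {n} {x y : Fin n} → (x ≡ᵇ y) ≡ false → x ≢ y
≡ᵇ-false⇒≢ {x = x} e refl with x ≟ x
... | no x≢x = x≢x refl

≡ᵇ-sym : ∀ {n} (x y : Fin n) → (x ≡ᵇ y) ≡ (y ≡ᵇ x)
≡ᵇ-sym x y with x ≟ y | y ≟ x
... | yes _     | yes _     = refl
... | no _      | no _      = refl
... | yes x≡y   | no y≢x    = ⊥-elim (y≢x (≡-sym x≡y))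
... | no x≢y    | yes y≡x   = ⊥-elim (x≢y (≡-sym y≡x))

≡true⇒≢false : ∀ {b} → b ≡ true → b ≢ false
≡true⇒≢false refl ()

∨-introˡ : ∀ {a} b → a ≡ true → a ∨ b ≡ true
∨-introˡ b refl = refl

∨-introʳ : ∀ a {b} → b ≡ true → a ∨ b ≡ true
∨-introʳ true  _ = refl
∨-introʳ false e = e

∨-elim : ∀ {a b} → a ∨ b ≡ true → a ≡ true ⊎ b ≡ true
∨-elim {true}  _ = inj₁ refl
∨-elim {false} e = inj₂ e

∧-elim : ∀ {a b} → a ∧ b ≡ true → a ≡ true × b ≡ true
∧-elim {true} {true} _ = refl , refl

not-true : ∀ {a} → not a ≡ true → a ≡ false
not-true {false} _ = refl

≡true-ext : ∀ {a b} → (a ≡ true → b ≡ true) → (b ≡ true → a ≡ true) → a ≡ b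
≡true-ext {true}  {true}  f g = refl
≡true-ext {true}  {false} f g = ≡-sym (f refl)
≡true-ext {false} {true}  f g = g refl
≡true-ext {false} {false} f g = refl

𝟙≤1 : ∀ b → 𝟙 b ≤ 1
𝟙≤1 true  = s≤s z≤n
𝟙≤1 false = z≤n

𝟙-mono : ∀ {a b} → (a ≡ true → b ≡ true) → 𝟙 a ≤ 𝟙 b
𝟙-mono {false} f = z≤n
𝟙-mono {true}  f rewrite f refl = ≤-refl

𝟙-∨∧ : ∀ a b m → 𝟙 ((a ∨ b) ∧ m) ≤ 𝟙 (a ∧ m) + 𝟙 (b ∧ m)
𝟙-∨∧ true  b true  = s≤s z≤n
𝟙-∨∧ true  b false = z≤n
𝟙-∨∧ false b m     = ≤-refl

if-then-0≡𝟙* : ∀ b x → (if b then x else 0) ≡ 𝟙 b * x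
if-then-0≡𝟙* true  x = ≡-sym (+-identityʳ x)
if-then-0≡𝟙* false x = refl

if-then-1≡𝟙 : ∀ b → (if b then 1 else 0) ≡ 𝟙 b
if-then-1≡𝟙 true  = refl
if-then-1≡𝟙 false = refl

<F⇒< : ∀ {m} {x y : Fin m} → x <F y ≡ true → toℕ x < toℕ y
<F⇒< {x = x} {y} p = <ᵇ⇒< (toℕ x) (toℕ y) (Equivalence.from Boolₚ.T-≡ p)

<⇒<F : ∀ {m} {x y : Fin m} → toℕ x < toℕ y → x <F y ≡ true
<⇒<F x<y = Equivalence.to Boolₚ.T-≡ (<⇒<ᵇ x<y)

≮⇒<F-false : ∀ {m} {x y : Fin m} → ¬ toℕ x < toℕ y → x <F y ≡ false
≮⇒<F-false {x = x} {y} x≮y with x <F y in e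
... | false = refl
... | true  = ⊥-elim (x≮y (<F⇒< e))

<F-trichotomy : ∀ {m} (x y : Fin m) →
  (x <F y ≡ true × y <F x ≡ false) ⊎ x ≡ y ⊎ (x <F y ≡ false × y <F x ≡ true)
<F-trichotomy x y with <-cmp (toℕ x) (toℕ y)
... | tri< x<y _ y≮x = inj₁ (<⇒<F {x = x} {y = y} x<y , ≮⇒<F-false {x = y} {y = x} y≮x)
... | tri≈ _ x≡y _   = inj₂ (inj₁ (toℕ-injective x≡y))
... | tri> x≮y _ y<x = inj₂ (inj₂ (≮⇒<F-false {x = x} {y = y} x≮y , <⇒<F {x = y} {y = x} y<x))

<F-irrefl : ∀ {m} (x : Fin m) → x <F x ≡ false
<F-irrefl x = ≮⇒<F-false {x = x} {y = x} (<-irrefl refl)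

<F-trans : ∀ {m} {x y z : Fin m} → x <F y ≡ true → y <F z ≡ true → x <F z ≡ true
<F-trans {x = x} {y} {z} p q = <⇒<F {x = x} {y = z} (<-trans (<F⇒< {x = x} {y = y} p) (<F⇒< {x = y} {y = z} q))

<F-asym : ∀ {m} (x y : Fin m) → x <F y ∧ y <F x ≡ false
<F-asym x y with <F-trichotomy x y
... | inj₁ (_ , y≮x)       rewrite y≮x = Boolₚ.∧-zeroʳ (x <F y)
... | inj₂ (inj₁ refl)     rewrite <F-irrefl x = refl
... | inj₂ (inj₂ (x≮y , _)) rewrite x≮y = refl

-- Finite sums

sumFin-cong : ∀ {n} {f g : Fin n → ℕ} → f ≗ g → sumFin n f ≡ sumFin n g
sumFin-cong {zero}  f≗g = refl
sumFin-cong {suc n} f≗g = cong₂ _+_ (f≗g F.zero) (sumFin-cong (λ i → f≗g (F.suc i)))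

sumFin-0 : ∀ n → sumFin n (λ _ → 0) ≡ 0
sumFin-0 zero    = refl
sumFin-0 (suc n) = sumFin-0 n

sumFin-≡0 : ∀ {n} {f : Fin n → ℕ} → (∀ i → f i ≡ 0) → sumFin n f ≡ 0
sumFin-≡0 {n} f≡0 = trans (sumFin-cong f≡0) (sumFin-0 n)

sumFin-+ : ∀ n (f g : Fin n → ℕ) → sumFin n (λ i → f i + g i) ≡ sumFin n f + sumFin n g
sumFin-+ zero    f g = refl
sumFin-+ (suc n) f g
  rewrite sumFin-+ n (λ i → f (F.suc i)) (λ i → g (F.suc i)) =
    interchange (f F.zero) (g F.zero) (sumFin n (λ i → f (F.suc i))) (sumFin n (λ i → g (F.suc i)))
  where
  interchange : ∀ a b c d → a + b + (c + d) ≡ a + c + (b + d)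
  interchange = solve-∀

sumFin-*ˡ : ∀ n k (f : Fin n → ℕ) → sumFin n (λ i → k * f i) ≡ k * sumFin n f
sumFin-*ˡ zero    k f = ≡-sym (*-zeroʳ k)
sumFin-*ˡ (suc n) k f
  rewrite sumFin-*ˡ n k (λ i → f (F.suc i)) = ≡-sym (*-distribˡ-+ k (f F.zero) _)

sumFin-const : ∀ n k → sumFin n (λ _ → k) ≡ n * k
sumFin-const zero    k = refl
sumFin-const (suc n) k = cong (k +_) (sumFin-const n k)

sumFin-comm : ∀ n m (f : Fin n → Fin m → ℕ) →
  sumFin n (λ i → sumFin m (f i)) ≡ sumFin m (λ j → sumFin n (λ i → f i j))
sumFin-comm zero    m f = ≡-sym (sumFin-0 m)
sumFin-comm (suc n) m f = trans
  (cong (sumFin m (f F.zero) +_) (sumFin-comm n m (λ i → f (F.suc i))))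
  (≡-sym (sumFin-+ m (f F.zero) (λ j → sumFin n (λ i → f (F.suc i) j))))

sumFin-mono-≤ : ∀ {n} {f g : Fin n → ℕ} → (∀ i → f i ≤ g i) → sumFin n f ≤ sumFin n g
sumFin-mono-≤ {zero}  f≤g = z≤n
sumFin-mono-≤ {suc n} f≤g = +-mono-≤ (f≤g F.zero) (sumFin-mono-≤ (λ i → f≤g (F.suc i)))

sumFin-mono-< : ∀ {n} {f g : Fin n → ℕ} → (∀ i → f i ≤ g i) → ∀ w → f w < g w →
                sumFin n f < sumFin n g
sumFin-mono-< {suc n} f≤g F.zero    lt = +-mono-<-≤ lt (sumFin-mono-≤ (λ i → f≤g (F.suc i)))
sumFin-mono-< {suc n} f≤g (F.suc w) lt = +-mono-≤-< (f≤g F.zero) (sumFin-mono-< (λ i → f≤g (F.suc i)) w lt)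

sumFin-δ : ∀ n (x : Fin n) (g : Fin n → ℕ) → sumFin n (λ i → if x ≡ᵇ i then g i else 0) ≡ g x
sumFin-δ (suc n) F.zero    g = trans (cong (g F.zero +_) (sumFin-0 n)) (+-identityʳ _)
sumFin-δ (suc n) (F.suc x) g = sumFin-δ n x (λ i → g (F.suc i))

sumFin-δ′ : ∀ n (x : Fin n) (g : Fin n → ℕ) → sumFin n (λ i → if i ≡ᵇ x then g i else 0) ≡ g x
sumFin-δ′ n x g =
  trans (sumFin-cong (λ i → cong (λ b → if b then g i else 0) (≡ᵇ-sym i x))) (sumFin-δ n x g)

-- Walks

_⊆E_ : ∀ {n} → ERel n → ERel n → Set
E ⊆E E' = ∀ a b → E a b ≡ true → E' a b ≡ true

IsSymmetric : ∀ {n} → ERel n → Set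
IsSymmetric E = ∀ a b → E a b ≡ E b a

mapʷ : ∀ {n} {E E' : ERel n} → E ⊆E E' →
       ∀ {u v k} → Walk E u v k → Walk E' u v k
mapʷ f here       = here
mapʷ f (step e W) = step (f _ _ e) (mapʷ f W)

here-inv : ∀ {n} {E : ERel n} {x y} → Walk E x y 0 → x ≡ y
here-inv here = refl

module _ {n : ℕ} {E : ERel n} where

  visits : ∀ {u v k} → Walk E u v k → Fin n → Bool
  visits {u} here       x = x ≡ᵇ u
  visits {u} (step e W) x = (x ≡ᵇ u) ∨ visits W x

  visits-start : ∀ {u v k} (W : Walk E u v k) → visits W u ≡ true
  visits-start {u} here = ≡ᵇ-refl u
  visits-start {u} (step e W) rewrite ≡ᵇ-refl u = refl

  visits-end : ∀ {u v k} (W : Walk E u v k) → visits W v ≡ true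
  visits-end {u}     here       = ≡ᵇ-refl u
  visits-end {u} {v} (step e W) = ∨-introʳ (v ≡ᵇ u) (visits-end W)

  _++ʷ_ : ∀ {u w v k m} → Walk E u w k → Walk E w v m → Walk E u v (k + m)
  here     ++ʷ W' = W'
  step e W ++ʷ W' = step e (W ++ʷ W')

  _∷ʳʷ_ : ∀ {u v w k} → Walk E u v k → E v w ≡ true → Walk E u w (suc k)
  here       ∷ʳʷ e = step e here
  step e' W  ∷ʳʷ e = step e' (W ∷ʳʷ e)

  visits-∷ʳ : ∀ {u v w k} (W : Walk E u v k) (e : E v w ≡ true) z →
              visits (W ∷ʳʷ e) z ≡ true → visits W z ≡ true ⊎ z ≡ w
  visits-∷ʳ {u} here e z p with ∨-elim {z ≡ᵇ u} p
  ... | inj₁ q = inj₁ q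
  ... | inj₂ q = inj₂ (≡ᵇ⇒≡ q)
  visits-∷ʳ {u} (step e' W) e z p with ∨-elim {z ≡ᵇ u} p
  ... | inj₁ q = inj₁ (∨-introˡ _ q)
  ... | inj₂ q with visits-∷ʳ W e z q
  ...   | inj₁ r = inj₁ (∨-introʳ (z ≡ᵇ u) r)
  ...   | inj₂ r = inj₂ r

  module _ (E-sym : IsSymmetric E) where

    reverseʷ : ∀ {u v k} → Walk E u v k → Walk E v u k
    reverseʷ here                   = here
    reverseʷ (step {u} {w} e W) = reverseʷ W ∷ʳʷ trans (E-sym w u) e

    visits-reverse : ∀ {u v k} (W : Walk E u v k) z → visits (reverseʷ W) z ≡ true → visits W z ≡ true
    visits-reverse here z p = p
    visits-reverse (step {u} {w} e W) z p with visits-∷ʳ (reverseʷ W) (trans (E-sym w u) e) z p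
    ... | inj₁ q    = ∨-introʳ (z ≡ᵇ u) (visits-reverse W z q)
    ... | inj₂ refl = ∨-introˡ _ (≡ᵇ-refl z)

  edges : ∀ {u v k} → Walk E u v k → ERel n
  edges here                 a b = false
  edges (step {u} {w} e W) a b = ((a ≡ᵇ u) ∧ (b ≡ᵇ w)) ∨ edges W a b

  edges-step : ∀ {u w v k} (e : E u w ≡ true) (W : Walk E w v k) {a b} →
               edges (step e W) a b ≡ true → (a ≡ u × b ≡ w) ⊎ edges W a b ≡ true
  edges-step {u} {w} e W {a} {b} q with ∨-elim {(a ≡ᵇ u) ∧ (b ≡ᵇ w)} q
  ... | inj₂ r = inj₂ r
  ... | inj₁ r with ∧-elim {a ≡ᵇ u} r
  ...   | r₁ , r₂ = inj₁ (≡ᵇ⇒≡ r₁ , ≡ᵇ⇒≡ r₂)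

  edges-elim : ∀ {u v k} (W : Walk E u v k) a b → edges W a b ≡ true →
               E a b ≡ true × visits W a ≡ true × visits W b ≡ true
  edges-elim (step {u} {w} e W) a b q with edges-step e W q
  ... | inj₁ (refl , refl) = e , ∨-introˡ _ (≡ᵇ-refl a) , ∨-introʳ (b ≡ᵇ a) (visits-start W)
  ... | inj₂ r with edges-elim W a b r
  ...   | eab , va , vb = eab , ∨-introʳ (a ≡ᵇ u) va , ∨-introʳ (b ≡ᵇ u) vb

  first-edge : ∀ {u w v k} (e : E u w ≡ true) (W : Walk E w v k) → edges (step e W) u w ≡ true
  first-edge {u} {w} e W rewrite ≡ᵇ-refl u | ≡ᵇ-refl w = refl

  record Split {u v k} (W : Walk E u v k) (y : Fin n) : Set where
    field
      {k₁ k₂} : ℕ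
      W₁ : Walk E u y k₁
      W₂ : Walk E y v k₂
      length : k₁ + k₂ ≡ k
      visits₁ : ∀ z → visits W₁ z ≡ true → visits W z ≡ true
      visits₂ : ∀ z → visits W₂ z ≡ true → visits W z ≡ true

  splitAt : ∀ {u v k} (W : Walk E u v k) y → visits W y ≡ true → Split W y
  splitAt {u} here y p with ≡ᵇ⇒≡ {x = y} {y = u} p
  ... | refl = record { W₁ = here ; W₂ = here ; length = refl
                      ; visits₁ = λ _ q → q ; visits₂ = λ _ q → q }
  splitAt {u} (step e W) y p with y ≟ u
  ... | yes refl = record { W₁ = here ; W₂ = step e W ; length = refl
                          ; visits₁ = λ _ q → ∨-introˡ _ q ; visits₂ = λ _ q → q }
  ... | no _ = record { W₁ = step e (Split.W₁ s) ; W₂ = Split.W₂ s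
                      ; length = cong suc (Split.length s)
                      ; visits₁ = visits₁
                      ; visits₂ = λ z q → ∨-introʳ (z ≡ᵇ u) (Split.visits₂ s z q) }
    where
    s : Split W y
    s = splitAt W y p
    visits₁ : ∀ z → (z ≡ᵇ u) ∨ visits (Split.W₁ s) z ≡ true → (z ≡ᵇ u) ∨ visits W z ≡ true
    visits₁ z q with ∨-elim {z ≡ᵇ u} q
    ... | inj₁ r = ∨-introˡ _ r
    ... | inj₂ r = ∨-introʳ (z ≡ᵇ u) (Split.visits₁ s z r)

restrict-elim : ∀ {n} (E : ERel n) (A : VSet n) a b → restrict E A a b ≡ true →
                E a b ≡ true × A a ≡ true × A b ≡ true
restrict-elim E A a b e with E a b | A a | A b
... | true | true | true = refl , refl , refl

restrict-intro : ∀ {n} (E : ERel n) (A : VSet n) a b → E a b ≡ true → A a ≡ true → A b ≡ true →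
                 restrict E A a b ≡ true
restrict-intro E A a b p q r rewrite p | q | r = refl

restrict-sym : ∀ {n} (E : ERel n) (A : VSet n) → IsSymmetric E → IsSymmetric (restrict E A)
restrict-sym E A E-sym a b rewrite E-sym a b | Boolₚ.∧-comm (A a) (A b) = refl

restrict-mono-vertices : ∀ {n} {E : ERel n} {A A' : VSet n} → A ⊆V A' → restrict E A ⊆E restrict E A'
restrict-mono-vertices {E = E} {A} {A'} A⊆A' a b e with restrict-elim E A a b e
... | p , q , r = restrict-intro E A' a b p (A⊆A' a q) (A⊆A' b r)

restrict-mono-edges : ∀ {n} {E E' : ERel n} (A : VSet n) → E ⊆E E' → restrict E A ⊆E restrict E' A
restrict-mono-edges {E = E} {E'} A E⊆E' a b e with restrict-elim E A a b e
... | p , q , r = restrict-intro E' A a b (E⊆E' a b p) q r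

restrictʷ : ∀ {n} {E : ERel n} (A : VSet n) {u v k} (W : Walk E u v k) →
            (∀ z → visits W z ≡ true → A z ≡ true) → Walk (restrict E A) u v k
restrictʷ A here W⊆A = here
restrictʷ {E = E} A (step {u} {w} e W) W⊆A =
  step (restrict-intro E A u w e (W⊆A u (∨-introˡ _ (≡ᵇ-refl u)))
                                 (W⊆A w (∨-introʳ (w ≡ᵇ u) (visits-start W))))
       (restrictʷ A W (λ z q → W⊆A z (∨-introʳ (z ≡ᵇ u) q)))

Reach-trans : ∀ {n} {E : ERel n} {u w v} → Reach E u w → Reach E w v → Reach E u v
Reach-trans (k , W) (m , W') = k + m , W ++ʷ W'

Reach-sym : ∀ {n} {E : ERel n} → IsSymmetric E → ∀ {u v} → Reach E u v → Reach E v u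
Reach-sym E-sym (k , W) = k , reverseʷ E-sym W

Reach-map : ∀ {n} {E E' : ERel n} → E ⊆E E' →
            ∀ {u v} → Reach E u v → Reach E' u v
Reach-map f (k , W) = k , mapʷ f W

walk-spans : ∀ {n} {E : ERel n} (Es : ERel n) (Vs : VSet n) {s e k} (W : Walk E s e k) →
  edges W ⊆E Es → (∀ z → visits W z ≡ true → Vs z ≡ true) →
  ∀ z → visits W z ≡ true → Reach (restrict Es Vs) s z
walk-spans Es Vs {s} here W⊆Es W⊆Vs z q with ≡ᵇ⇒≡ {x = z} {y = s} q
... | refl = 0 , here
walk-spans Es Vs (step {u} {w} e W) W⊆Es W⊆Vs z q with ∨-elim {z ≡ᵇ u} q
... | inj₁ r with ≡ᵇ⇒≡ {x = z} r
...   | refl = 0 , here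
walk-spans Es Vs (step {u} {w} e W) W⊆Es W⊆Vs z q | inj₂ r
  with walk-spans Es Vs W (λ a b o → W⊆Es a b (∨-introʳ ((a ≡ᵇ u) ∧ (b ≡ᵇ w)) o))
                          (λ z' o → W⊆Vs z' (∨-introʳ (z' ≡ᵇ u) o)) z r
... | k , P = suc k , step (restrict-intro Es Vs u w (W⊆Es u w (first-edge e W))
                                                  (W⊆Vs u (visits-start (step e W)))
                                                  (W⊆Vs w (∨-introʳ (w ≡ᵇ u) (visits-start W)))) P

connectedOn-viaHub : ∀ {n} (E : ERel n) → IsSymmetric E → (A H : VSet n) → H ⊆V A →
  ConnectedOn E H → (∀ y → A y ≡ true → ∃[ h ] H h ≡ true × Reach (restrict E A) y h) →
  ConnectedOn E A
connectedOn-viaHub E E-sym A H H⊆A H-conn toHub y z ay az with toHub y ay | toHub z az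
... | h₁ , hh₁ , y↝h₁ | h₂ , hh₂ , z↝h₂ =
  Reach-trans y↝h₁ (Reach-trans (Reach-map (restrict-mono-vertices {E = E} H⊆A) (H-conn h₁ h₂ hh₁ hh₂))
                                (Reach-sym (restrict-sym E A E-sym) z↝h₂))

removeV-elim : ∀ {n} (C : VSet n) w y → removeV C w y ≡ true → C y ≡ true × y ≢ w
removeV-elim C w y e with C y | y ≟ w
... | true | no y≢w = refl , y≢w

removeV-intro : ∀ {n} (C : VSet n) w y → C y ≡ true → y ≢ w → removeV C w y ≡ true
removeV-intro C w y cy y≢w with C y | y ≟ w
... | true | no _    = refl
... | true | yes y≡w = ⊥-elim (y≢w y≡w)

removeV-mono : ∀ {n} {C D : VSet n} w → C ⊆V D → removeV C w ⊆V removeV D w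
removeV-mono {C = C} {D} w C⊆D y p with removeV-elim C w y p
... | cy , y≢w = removeV-intro D w y (C⊆D y cy) y≢w

-- Blocks

_∪V_ : ∀ {n} → VSet n → VSet n → VSet n
(C ∪V D) z = C z ∨ D z

module Blocks {n : ℕ} (G : Graph n) where

  adj-sym : IsSymmetric (adj G)
  adj-sym = sym G

  adj⇒≢ : ∀ {u v} → adj G u v ≡ true → u ≢ v
  adj⇒≢ {u} e refl = ≡true⇒≢false e (irrefl G u)

  nonseparable-removeV : ∀ {C} → Nonseparable G C → ∀ w → ConnectedOn (adj G) (removeV C w)
  nonseparable-removeV {C} (_ , C-conn , C-rem) w with C w in cw
  ... | true  = C-rem w cw
  ... | false = λ y z ry rz →
    Reach-map (restrict-mono-vertices {E = adj G} C⊆C∖w)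
              (C-conn y z (proj₁ (removeV-elim C w y ry)) (proj₁ (removeV-elim C w z rz)))
    where
    C⊆C∖w : C ⊆V removeV C w
    C⊆C∖w y cy = removeV-intro C w y cy (λ { refl → ≡true⇒≢false cy cw })

  G∖_ : VSet n → ERel n
  G∖ C = deleteBlockEdges G C

  G∖⊆adj : ∀ C → (G∖ C) ⊆E adj G
  G∖⊆adj C a b e with adj G a b
  ... | true = refl

  G∖-leaves : ∀ C a b → (G∖ C) a b ≡ true → C a ≡ true → C b ≡ false
  G∖-leaves C a b e ca with adj G a b | C a | C b
  ... | true | true | false = refl

  G∖-sym : ∀ C → IsSymmetric (G∖ C)
  G∖-sym C a b rewrite adj-sym a b | Boolₚ.∧-comm (C a) (C b) = refl

  -- C together with a walk of G ∖ C joining two of its vertices is nonseparable provided no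
  -- shorter such walk exists, so by maximality of the block C no such walk exists at all.
  module Bypass {C : VSet n} (C-block : IsBlock G C) {u v k} (cu : C u ≡ true) (cv : C v ≡ true)
                (W : Walk (G∖ C) u v k) where

    S : VSet n
    S = C ∪V visits W

    C⊆S : C ⊆V S
    C⊆S y cy = ∨-introˡ _ cy

    W⊆S : ∀ y → visits W y ≡ true → S y ≡ true
    W⊆S y p = ∨-introʳ (C y) p

    liftToG : ∀ A {a b j} → Walk (restrict (G∖ C) A) a b j → Walk (restrict (adj G) A) a b j
    liftToG A = mapʷ (restrict-mono-edges A (G∖⊆adj C))

    backToStart : ∀ A {y} (sp : Split W y) → (∀ z → visits (Split.W₁ sp) z ≡ true → A z ≡ true) →
                  Reach (restrict (adj G) A) y u
    backToStart A sp W₁⊆A = _ , liftToG A (restrictʷ A (reverseʷ (G∖-sym C) (Split.W₁ sp))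
      (λ z q → W₁⊆A z (visits-reverse (G∖-sym C) (Split.W₁ sp) z q)))

    onToEnd : ∀ A {y} (sp : Split W y) → (∀ z → visits (Split.W₂ sp) z ≡ true → A z ≡ true) →
              Reach (restrict (adj G) A) y v
    onToEnd A sp W₂⊆A = _ , liftToG A (restrictʷ A (Split.W₂ sp) W₂⊆A)

    S-connected : ConnectedOn (adj G) S
    S-connected = connectedOn-viaHub (adj G) adj-sym S C C⊆S (proj₁ (proj₂ (proj₁ C-block))) toC
      where
      toC : ∀ y → S y ≡ true → ∃[ h ] C h ≡ true × Reach (restrict (adj G) S) y h
      toC y sy with ∨-elim {C y} sy
      ... | inj₁ cy = y , cy , (0 , here)
      ... | inj₂ wy = u , cu , backToStart S sp (λ z q → W⊆S z (Split.visits₁ sp z q))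
        where
        sp : Split W y
        sp = splitAt W y wy

    shortcut : ∀ {x y} → y ≢ x → (sp : Split W y) →
               visits (Split.W₁ sp) x ≡ true → visits (Split.W₂ sp) x ≡ true →
               ∃[ j ] j < k × Walk (G∖ C) u v j
    shortcut {x} y≢x sp x∈W₁ x∈W₂ =
      _ , subst (Split.k₁ s₁ + Split.k₂ s₂ <_)
                (trans (cong₂ _+_ (Split.length s₁) (Split.length s₂)) (Split.length sp))
                (skip-middle {Split.k₁ s₁} {Split.k₁ s₂} {Split.k₂ s₂} (Split.k₂ s₁)
                             (positive (Split.W₂ s₁)))
        , Split.W₁ s₁ ++ʷ Split.W₂ s₂
      where
      s₁ : Split (Split.W₁ sp) x
      s₁ = splitAt (Split.W₁ sp) x x∈W₁
      s₂ : Split (Split.W₂ sp) x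
      s₂ = splitAt (Split.W₂ sp) x x∈W₂
      positive : ∀ {j} → Walk (G∖ C) _ _ j → 0 < j
      positive {zero}  P = ⊥-elim (y≢x (≡-sym (here-inv P)))
      positive {suc j} P = s≤s z≤n
      skip-middle : ∀ {a c e} b → 0 < b → a + e < a + b + (c + e)
      skip-middle {a} {c} {e} (suc b) _ = subst (a + e <_) (rearrange a b c e) (s≤s (m≤m+n (a + e) (b + c)))
        where
        rearrange : ∀ a b c e → suc (a + e + (b + c)) ≡ a + suc b + (c + e)
        rearrange = solve-∀

    module _ (noShorter : ∀ {j} → j < k → ¬ Walk (G∖ C) u v j) where

      S-removeV-connected : ∀ x → ConnectedOn (adj G) (removeV S x)
      S-removeV-connected x = connectedOn-viaHub (adj G) adj-sym (removeV S x) (removeV C x)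
          (removeV-mono x C⊆S) (nonseparable-removeV (proj₁ C-block) x) toC
        where
        avoids : ∀ {a b j} (P : Walk (G∖ C) a b j) → visits P x ≡ false →
                 ∀ z → visits P z ≡ true → z ≢ x
        avoids P x∉P z z∈P refl = ≡true⇒≢false z∈P x∉P

        viaSplit : ∀ {y} → y ≢ x → (sp : Split W y) →
                   ∃[ h ] removeV C x h ≡ true × Reach (restrict (adj G) (removeV S x)) y h
        viaSplit y≢x sp with visits (Split.W₁ sp) x in onW₁
        ... | false = u , removeV-intro C x u cu (avoids (Split.W₁ sp) onW₁ u (visits-start (Split.W₁ sp)))
                    , backToStart (removeV S x) sp
                        (λ z q → removeV-intro S x z (W⊆S z (Split.visits₁ sp z q))
                                                     (avoids (Split.W₁ sp) onW₁ z q))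
        ... | true with visits (Split.W₂ sp) x in onW₂
        ...   | false = v , removeV-intro C x v cv (avoids (Split.W₂ sp) onW₂ v (visits-end (Split.W₂ sp)))
                      , onToEnd (removeV S x) sp
                          (λ z q → removeV-intro S x z (W⊆S z (Split.visits₂ sp z q))
                                                       (avoids (Split.W₂ sp) onW₂ z q))
        ...   | true with shortcut y≢x sp onW₁ onW₂
        ...     | _ , j<k , P = ⊥-elim (noShorter j<k P)

        toC : ∀ y → removeV S x y ≡ true →
              ∃[ h ] removeV C x h ≡ true × Reach (restrict (adj G) (removeV S x)) y h
        toC y ry with removeV-elim S x y ry
        ... | sy , y≢x with ∨-elim {C y} sy
        ...   | inj₁ cy = y , removeV-intro C x y cy y≢x , (0 , here)
        ...   | inj₂ wy = viaSplit y≢x (splitAt W y wy)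

      S⊆C : S ⊆V C
      S⊆C = proj₂ C-block S C⊆S ((u , C⊆S u cu) , S-connected , λ x _ → S-removeV-connected x)

  noBypass : ∀ {C} → IsBlock G C → ∀ {u v} → C u ≡ true → C v ≡ true → u ≢ v →
             ∀ k → ¬ Walk (G∖ C) u v k
  noBypass {C} C-block {u} {v} cu cv u≢v = <-rec (λ k → ¬ Walk (G∖ C) u v k) go
    where
    go : ∀ k → (∀ {j} → j < k → ¬ Walk (G∖ C) u v j) → ¬ Walk (G∖ C) u v k
    go _ _         here                       = u≢v refl
    go _ noShorter W@(step {w = x} e W′) =
      ≡true⇒≢false (S⊆C noShorter x (W⊆S x (∨-introʳ (x ≡ᵇ u) (visits-start W′))))
                   (G∖-leaves C u x e cu)
      where open Bypass C-block cu cv W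

  nonseparable-∪ : ∀ {C D} → Nonseparable G C → Nonseparable G D → ∀ {x y} → x ≢ y →
                   C x ≡ true → C y ≡ true → D x ≡ true → D y ≡ true → Nonseparable G (C ∪V D)
  nonseparable-∪ {C} {D} C-ns@(_ , C-conn , _) D-ns@(_ , D-conn , _) {x} {y} x≢y cx cy dx dy =
    (x , C⊆S x cx) , S-connected , λ w _ → S-removeV-connected w
    where
    S = C ∪V D
    C⊆S : C ⊆V S
    C⊆S z p = ∨-introˡ _ p
    D⊆S : D ⊆V S
    D⊆S z p = ∨-introʳ (C z) p

    S-connected : ConnectedOn (adj G) S
    S-connected = connectedOn-viaHub (adj G) adj-sym S C C⊆S C-conn toC
      where
      toC : ∀ z → S z ≡ true → ∃[ h ] C h ≡ true × Reach (restrict (adj G) S) z h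
      toC z sz with ∨-elim {C z} sz
      ... | inj₁ cz = z , cz , (0 , here)
      ... | inj₂ dz = x , cx , Reach-map (restrict-mono-vertices {E = adj G} D⊆S) (D-conn z x dz dx)

    S-removeV-connected : ∀ w → ConnectedOn (adj G) (removeV S w)
    S-removeV-connected w = connectedOn-viaHub (adj G) adj-sym (removeV S w) (removeV C w)
        (removeV-mono w C⊆S) (nonseparable-removeV C-ns w) toC
      where
      common : ∃[ h ] C h ≡ true × D h ≡ true × h ≢ w
      common with x ≟ w
      ... | yes refl = y , cy , dy , λ y≡x → x≢y (≡-sym y≡x)
      ... | no x≢w   = x , cx , dx , x≢w

      toC : ∀ z → removeV S w z ≡ true →
            ∃[ h ] removeV C w h ≡ true × Reach (restrict (adj G) (removeV S w)) z h
      toC z rz with removeV-elim S w z rz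
      ... | sz , z≢w with ∨-elim {C z} sz | common
      ...   | inj₁ cz | _ = z , removeV-intro C w z cz z≢w , (0 , here)
      ...   | inj₂ dz | h , ch , dh , h≢w = h , removeV-intro C w h ch h≢w ,
        Reach-map (restrict-mono-vertices {E = adj G} (removeV-mono w D⊆S))
          (nonseparable-removeV D-ns w z h (removeV-intro D w z dz z≢w) (removeV-intro D w h dh h≢w))

  blocks-share-two⇒≗ : ∀ {C D} → IsBlock G C → IsBlock G D → ∀ {x y} → x ≢ y →
                       C x ≡ true → C y ≡ true → D x ≡ true → D y ≡ true → C ≗ D
  blocks-share-two⇒≗ {C} {D} (C-ns , C-max) (D-ns , D-max) x≢y cx cy dx dy u =
    ≡true-ext (λ p → D-max (C ∪V D) (λ z q → ∨-introʳ (C z) q) C∪D-ns u (∨-introˡ _ p))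
              (λ p → C-max (C ∪V D) (λ z q → ∨-introˡ _ q) C∪D-ns u (∨-introʳ (C u) p))
    where
    C∪D-ns : Nonseparable G (C ∪V D)
    C∪D-ns = nonseparable-∪ C-ns D-ns x≢y cx cy dx dy

  size : VSet n → ℕ
  size S = sumFin n (λ u → 𝟙 (S u))

  size≤n : ∀ S → size S ≤ n
  size≤n S = ≤-trans (sumFin-mono-≤ (λ u → 𝟙≤1 (S u)))
                     (≤-reflexive (trans (sumFin-const n 1) (*-identityʳ n)))

  size-mono-< : ∀ {S S'} → S ⊆V S' → ∀ w → S' w ≡ true → S w ≡ false → size S < size S'
  size-mono-< {S} {S'} S⊆S' w p q =
    sumFin-mono-< (λ u → 𝟙-mono (S⊆S' u)) w
                  (subst₂ (λ a b → 𝟙 a < 𝟙 b) (≡-sym q) (≡-sym p) (s≤s z≤n))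

  -- Maximality is not decidable, so the block is obtained only under double negation; the
  -- enlargement terminates because size S grows and n ≤ size S + k bounds the remaining steps.
  nonseparable⊆block : ∀ S → Nonseparable G S → ¬ ¬ (∃[ C ] IsBlock G C × S ⊆V C)
  nonseparable⊆block S S-ns = extend n S S-ns (m≤n+m n (size S))
    where
    extend : ∀ k S → Nonseparable G S → n ≤ size S + k → ¬ ¬ (∃[ C ] IsBlock G C × S ⊆V C)
    extend k S S-ns n≤ no-block = no-block (S , (S-ns , S-max) , λ u p → p)
      where
      S-max : ∀ S' → S ⊆V S' → Nonseparable G S' → S' ⊆V S
      S-max S' S⊆S' S'-ns u s'u with S u in su
      ... | true  = refl
      ... | false = ⊥-elim (bigger k n≤)
        where
        grows : size S < size S'
        grows = size-mono-< S⊆S' u s'u su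
        bigger : ∀ k → n ≤ size S + k → ⊥
        bigger zero    b = <⇒≱ (≤-trans grows (size≤n S')) (subst (n ≤_) (+-identityʳ _) b)
        bigger (suc k) b = extend k S' S'-ns
          (≤-trans b (subst (_≤ size S' + k) (≡-sym (+-suc (size S) k)) (+-monoˡ-≤ k grows)))
          (λ { (C , C-block , S'⊆C) → no-block (C , C-block , λ z p → S'⊆C z (S⊆S' z p)) })

  edge-nonseparable : ∀ {u v} → adj G u v ≡ true → Nonseparable G (λ z → (z ≡ᵇ u) ∨ (z ≡ᵇ v))
  edge-nonseparable {u} {v} e = (u , Pu) , P-conn , P-rem
    where
    P : VSet n
    P z = (z ≡ᵇ u) ∨ (z ≡ᵇ v)
    Pu : P u ≡ true
    Pu = ∨-introˡ _ (≡ᵇ-refl u)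
    Pv : P v ≡ true
    Pv = ∨-introʳ (v ≡ᵇ u) (≡ᵇ-refl v)
    cases : ∀ z → P z ≡ true → z ≡ u ⊎ z ≡ v
    cases z p with ∨-elim {z ≡ᵇ u} p
    ... | inj₁ q = inj₁ (≡ᵇ⇒≡ q)
    ... | inj₂ q = inj₂ (≡ᵇ⇒≡ q)
    P-conn : ConnectedOn (adj G) P
    P-conn y z py pz with cases y py | cases z pz
    ... | inj₁ refl | inj₁ refl = 0 , here
    ... | inj₁ refl | inj₂ refl = 1 , step (restrict-intro (adj G) P u v e Pu Pv) here
    ... | inj₂ refl | inj₁ refl = 1 , step (restrict-intro (adj G) P v u (trans (adj-sym v u) e) Pv Pu) here
    ... | inj₂ refl | inj₂ refl = 0 , here
    P-rem : ∀ x → P x ≡ true → ConnectedOn (adj G) (removeV P x)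
    P-rem x px y z ry rz with removeV-elim P x y ry | removeV-elim P x z rz
    ... | py , y≢x | pz , z≢x with cases x px | cases y py | cases z pz
    ... | _      | inj₁ refl | inj₁ refl = 0 , here
    ... | _      | inj₂ refl | inj₂ refl = 0 , here
    ... | inj₁ p | inj₁ q    | inj₂ _    = ⊥-elim (y≢x (trans q (≡-sym p)))
    ... | inj₂ p | inj₁ _    | inj₂ r    = ⊥-elim (z≢x (trans r (≡-sym p)))
    ... | inj₁ p | inj₂ _    | inj₁ r    = ⊥-elim (z≢x (trans r (≡-sym p)))
    ... | inj₂ p | inj₂ q    | inj₁ _    = ⊥-elim (y≢x (trans q (≡-sym p)))

  edge⊆block : ∀ {u v} → adj G u v ≡ true → ¬ ¬ (∃[ C ] IsBlock G C × C u ≡ true × C v ≡ true)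
  edge⊆block {u} {v} e no-block = nonseparable⊆block _ (edge-nonseparable e)
    (λ { (C , C-block , P⊆C) →
         no-block (C , C-block , P⊆C u (∨-introˡ _ (≡ᵇ-refl u))
                               , P⊆C v (∨-introʳ (v ≡ᵇ u) (≡ᵇ-refl v))) })

-- Counting ordered pairs

sum² : ∀ {n} → (Fin n → Fin n → ℕ) → ℕ
sum² {n} f = sumFin n λ u → sumFin n λ v → f u v

sum²-cong : ∀ {n} {f g : Fin n → Fin n → ℕ} → (∀ u v → f u v ≡ g u v) → sum² f ≡ sum² g
sum²-cong f≡g = sumFin-cong (λ u → sumFin-cong (f≡g u))

sum²-+ : ∀ {n} (f g : Fin n → Fin n → ℕ) → sum² (λ u v → f u v + g u v) ≡ sum² f + sum² g
sum²-+ {n} f g = trans (sumFin-cong (λ u → sumFin-+ n (f u) (g u))) (sumFin-+ n _ _)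

sum²-mono-≤ : ∀ {n} {f g : Fin n → Fin n → ℕ} → (∀ u v → f u v ≤ g u v) → sum² f ≤ sum² g
sum²-mono-≤ f≤g = sumFin-mono-≤ (λ u → sumFin-mono-≤ (f≤g u))

sum²-transpose : ∀ {n} (f : Fin n → Fin n → ℕ) → sum² (λ u v → f v u) ≡ sum² f
sum²-transpose {n} f = sumFin-comm n n (λ u v → f v u)

#pairs : ∀ {n} → ERel n → ℕ
#pairs P = sum² (λ u v → 𝟙 (P u v))

#pairs-singleton : ∀ {n} (x y : Fin n) → #pairs (λ u v → (u ≡ᵇ x) ∧ (v ≡ᵇ y)) ≡ 1
#pairs-singleton {n} x y = trans (sumFin-cong row) (sumFin-δ′ n x (λ _ → 1))
  where
  row : ∀ u → sumFin n (λ v → 𝟙 ((u ≡ᵇ x) ∧ (v ≡ᵇ y))) ≡ (if u ≡ᵇ x then 1 else 0)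
  row u with u ≡ᵇ x
  ... | false = sumFin-0 n
  ... | true  = trans (sumFin-cong (λ v → ≡-sym (if-then-1≡𝟙 (v ≡ᵇ y)))) (sumFin-δ′ n y (λ _ → 1))

#pairs-at : ∀ {n} (x y : Fin n) (Q : ERel n) →
            #pairs (λ u v → ((u ≡ᵇ x) ∧ (v ≡ᵇ y)) ∧ Q u v) ≡ 𝟙 (Q x y)
#pairs-at {n} x y Q = trans (sum²-cong (λ u v → cong 𝟙 (at u v))) (only (Q x y))
  where
  at : ∀ u v → ((u ≡ᵇ x) ∧ (v ≡ᵇ y)) ∧ Q u v ≡ ((u ≡ᵇ x) ∧ (v ≡ᵇ y)) ∧ Q x y
  at u v with u ≟ x | v ≟ y
  ... | yes refl | yes refl = refl
  ... | yes refl | no _     = refl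
  ... | no _     | _        = refl
  only : ∀ b → #pairs (λ u v → ((u ≡ᵇ x) ∧ (v ≡ᵇ y)) ∧ b) ≡ 𝟙 b
  only true  = trans (sum²-cong (λ u v → cong 𝟙 (Boolₚ.∧-identityʳ ((u ≡ᵇ x) ∧ (v ≡ᵇ y)))))
                     (#pairs-singleton x y)
  only false = trans (sum²-cong (λ u v → cong 𝟙 (Boolₚ.∧-zeroʳ ((u ≡ᵇ x) ∧ (v ≡ᵇ y)))))
                     (sumFin-≡0 {n} (λ u → sumFin-0 n))

_∖⟨_,_⟩ : ∀ {n} → ERel n → Fin n → Fin n → ERel n
(P ∖⟨ x , y ⟩) u v = P u v ∧ not ((u ≡ᵇ x) ∧ (v ≡ᵇ y))

#pairs-remove : ∀ {n} (P : ERel n) {x y} → P x y ≡ true → #pairs P ≡ suc (#pairs (P ∖⟨ x , y ⟩))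
#pairs-remove P {x} {y} pxy =
  trans (sum²-cong split)
        (trans (sum²-+ (λ u v → 𝟙 ((u ≡ᵇ x) ∧ (v ≡ᵇ y))) (λ u v → 𝟙 ((P ∖⟨ x , y ⟩) u v)))
               (cong (_+ #pairs (P ∖⟨ x , y ⟩)) (#pairs-singleton x y)))
  where
  split : ∀ u v → 𝟙 (P u v) ≡ 𝟙 ((u ≡ᵇ x) ∧ (v ≡ᵇ y)) + 𝟙 ((P ∖⟨ x , y ⟩) u v)
  split u v with u ≟ x | v ≟ y
  ... | yes refl | yes refl rewrite pxy = refl
  ... | yes refl | no _     rewrite Boolₚ.∧-identityʳ (P u v) = refl
  ... | no _     | yes refl rewrite Boolₚ.∧-identityʳ (P u v) = refl
  ... | no _     | no _     rewrite Boolₚ.∧-identityʳ (P u v) = refl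

∖⟨⟩-keeps : ∀ {n} (P : ERel n) {x y u v} → P u v ≡ true → ¬ (u ≡ x × v ≡ y) →
            (P ∖⟨ x , y ⟩) u v ≡ true
∖⟨⟩-keeps P {x} {y} {u} {v} puv ne with u ≟ x | v ≟ y
... | yes refl | yes refl = ⊥-elim (ne (refl , refl))
... | yes _    | no _     rewrite puv = refl
... | no _     | yes _    rewrite puv = refl
... | no _     | no _     rewrite puv = refl

module _ {n : ℕ} (P : ERel n) where

  BothWays : Fin n → Fin n → Set
  BothWays x y = P x y ≡ true × P y x ≡ true

  #pairs≥2 : ∀ {x y} → BothWays x y → x ≢ y → 2 ≤ #pairs P
  #pairs≥2 {x} {y} (pxy , pyx) x≢y
    rewrite #pairs-remove P pxy
          | #pairs-remove (P ∖⟨ x , y ⟩) (∖⟨⟩-keeps P pyx (λ (y≡x , _) → x≢y (≡-sym y≡x)))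
    = s≤s (s≤s z≤n)

  #pairs≥4 : ∀ {x y x' y'} → BothWays x y → BothWays x' y' → x ≢ y → x' ≢ y' →
             ¬ (x ≡ x' × y ≡ y') → ¬ (x ≡ y' × y ≡ x') → 4 ≤ #pairs P
  #pairs≥4 {x} {y} {x'} {y'} (pxy , pyx) (px'y' , py'x') x≢y x'≢y' ne₁ ne₂
    = ≤-trans (m≤m+n 4 _) (≤-reflexive (≡-sym count))
    where
    open ≡-Reasoning
    P₁ P₂ P₃ : ERel n
    P₁ = P ∖⟨ x , y ⟩
    P₂ = P₁ ∖⟨ y , x ⟩
    P₃ = P₂ ∖⟨ x' , y' ⟩
    p₁ : P₁ y x ≡ true
    p₁ = ∖⟨⟩-keeps P pyx (λ (y≡x , _) → x≢y (≡-sym y≡x))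
    p₂ : P₂ x' y' ≡ true
    p₂ = ∖⟨⟩-keeps P₁ (∖⟨⟩-keeps P px'y' (λ (a , b) → ne₁ (≡-sym a , ≡-sym b)))
                      (λ (a , b) → ne₂ (≡-sym b , ≡-sym a))
    p₃ : P₃ y' x' ≡ true
    p₃ = ∖⟨⟩-keeps P₂ (∖⟨⟩-keeps P₁ (∖⟨⟩-keeps P py'x' (λ (a , b) → ne₂ (≡-sym a , ≡-sym b)))
                                     (λ (a , b) → ne₁ (≡-sym b , ≡-sym a)))
                      (λ (y'≡x' , _) → x'≢y' (≡-sym y'≡x'))
    count : #pairs P ≡ 4 + #pairs (P₃ ∖⟨ y' , x' ⟩)
    count = begin
      #pairs P                  ≡⟨ #pairs-remove P pxy ⟩
      1 + #pairs P₁             ≡⟨ cong suc (#pairs-remove P₁ p₁) ⟩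
      2 + #pairs P₂             ≡⟨ cong (2 +_) (#pairs-remove P₂ p₂) ⟩
      3 + #pairs P₃             ≡⟨ cong (3 +_) (#pairs-remove P₃ p₃) ⟩
      4 + #pairs (P₃ ∖⟨ y' , x' ⟩) ∎

2*edgeCount≡#pairs : ∀ {n} (Es : ERel n) → IsSymmetric Es → (∀ u → Es u u ≡ false) →
                     2 * edgeCount n Es ≡ #pairs Es
2*edgeCount≡#pairs {n} Es Es-sym Es-irrefl = begin
  2 * edgeCount n Es    ≡⟨ cong (2 *_) upper≡ ⟩
  2 * upper             ≡⟨ cong (λ z → upper + z) (+-identityʳ upper) ⟩
  upper + upper         ≡⟨ cong (upper +_) (≡-sym lower≡upper) ⟩
  upper + lower
    ≡⟨ ≡-sym (sum²-+ (λ u v → 𝟙 (u <F v ∧ Es u v)) (λ u v → 𝟙 (v <F u ∧ Es u v))) ⟩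
  sum² (λ u v → 𝟙 (u <F v ∧ Es u v) + 𝟙 (v <F u ∧ Es u v))
    ≡⟨ sum²-cong (λ u v → ≡-sym (split u v)) ⟩
  #pairs Es             ∎
  where
  open ≡-Reasoning
  upper lower : ℕ
  upper = #pairs (λ u v → u <F v ∧ Es u v)
  lower = #pairs (λ u v → v <F u ∧ Es u v)
  upper≡ : edgeCount n Es ≡ upper
  upper≡ = sum²-cong (λ u v → if-then-1≡𝟙 (u <F v ∧ Es u v))
  lower≡upper : lower ≡ upper
  lower≡upper = trans (sum²-cong (λ u v → cong (λ b → 𝟙 (v <F u ∧ b)) (Es-sym u v)))
                      (sum²-transpose (λ u v → 𝟙 (u <F v ∧ Es u v)))
  split : ∀ u v → 𝟙 (Es u v) ≡ 𝟙 (u <F v ∧ Es u v) + 𝟙 (v <F u ∧ Es u v)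
  split u v with <F-trichotomy u v
  ... | inj₁ (u<v , v≮u)      rewrite u<v | v≮u = ≡-sym (+-identityʳ _)
  ... | inj₂ (inj₁ refl)      rewrite <F-irrefl u | Es-irrefl u = refl
  ... | inj₂ (inj₂ (u≮v , v<u)) rewrite u≮v | v<u = refl


-- Sums over pairs and triples

sumPairs : ∀ m → (Fin m → Fin m → ℕ) → ℕ
sumPairs m f = sumFin m λ u → sumFin m λ v → if u <F v then f u v else 0

sumTriples : ∀ m → (Fin m → Fin m → Fin m → ℕ) → ℕ
sumTriples m f = sumFin m λ a → sumFin m λ b → sumFin m λ c → if a <F b ∧ b <F c then f a b c else 0

if-+ : ∀ b x y → (if b then x + y else 0) ≡ (if b then x else 0) + (if b then y else 0)
if-+ true  x y = refl
if-+ false x y = refl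

if-* : ∀ k b x → k * (if b then x else 0) ≡ (if b then k * x else 0)
if-* k true  x = refl
if-* k false x = *-zeroʳ k

if-sumFin : ∀ t b (f : Fin t → ℕ) → (if b then sumFin t f else 0) ≡ sumFin t (λ i → if b then f i else 0)
if-sumFin t true  f = refl
if-sumFin t false f = ≡-sym (sumFin-0 t)

sumPairs-+ : ∀ m f g → sumPairs m (λ u v → f u v + g u v) ≡ sumPairs m f + sumPairs m g
sumPairs-+ m f g = trans (sumFin-cong (λ u → trans (sumFin-cong (λ v → if-+ (u <F v) (f u v) (g u v)))
                                                   (sumFin-+ m _ _)))
                         (sumFin-+ m _ _)

sumTriples-+ : ∀ m f g → sumTriples m (λ a b c → f a b c + g a b c) ≡ sumTriples m f + sumTriples m g
sumTriples-+ m f g =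
  trans (sumFin-cong (λ a → trans (sumFin-cong (λ b →
          trans (sumFin-cong (λ c → if-+ (a <F b ∧ b <F c) (f a b c) (g a b c))) (sumFin-+ m _ _)))
        (sumFin-+ m _ _)))
  (sumFin-+ m _ _)

sumTriples-*ˡ : ∀ m k (f : Fin m → Fin m → Fin m → ℕ) →
                k * sumTriples m f ≡ sumTriples m (λ a b c → k * f a b c)
sumTriples-*ˡ m k f =
  trans (≡-sym (sumFin-*ˡ m k _)) (sumFin-cong (λ a → trans (≡-sym (sumFin-*ˡ m k _)) (sumFin-cong (λ b →
  trans (≡-sym (sumFin-*ˡ m k _)) (sumFin-cong (λ c → if-* k (a <F b ∧ b <F c) (f a b c)))))))

sumTriples-cong : ∀ m {f g : Fin m → Fin m → Fin m → ℕ} →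
  (∀ a b c → a <F b ≡ true → b <F c ≡ true → f a b c ≡ g a b c) → sumTriples m f ≡ sumTriples m g
sumTriples-cong m {f} {g} f≡g = sumFin-cong (λ a → sumFin-cong (λ b → sumFin-cong (λ c → on a b c)))
  where
  on : ∀ a b c → (if a <F b ∧ b <F c then f a b c else 0) ≡ (if a <F b ∧ b <F c then g a b c else 0)
  on a b c with a <F b in ab | b <F c in bc
  ... | true  | true  = f≡g a b c ab bc
  ... | true  | false = refl
  ... | false | _     = refl

sumTriples-sumFin : ∀ m t (f : Fin t → Fin m → Fin m → Fin m → ℕ) →
  sumTriples m (λ a b c → sumFin t (λ i → f i a b c)) ≡ sumFin t (λ i → sumTriples m (f i))
sumTriples-sumFin m t f =
  trans (sumFin-cong (λ a → trans (sumFin-cong (λ b →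
          trans (sumFin-cong (λ c → if-sumFin t (a <F b ∧ b <F c) (λ i → f i a b c))) (sumFin-comm m t _)))
        (sumFin-comm m t _)))
  (sumFin-comm m t _)

sumTriples-suc : ∀ m (f : Fin (suc m) → Fin (suc m) → Fin (suc m) → ℕ) →
  sumTriples (suc m) f ≡ sumPairs m (λ b c → f F.zero (F.suc b) (F.suc c))
                       + sumTriples m (λ a b c → f (F.suc a) (F.suc b) (F.suc c))
sumTriples-suc m f = cong₂ _+_ (cong (_+ sumPairs m (λ b c → f F.zero (F.suc b) (F.suc c))) (sumFin-0 (suc m)))
                               (sumFin-cong from-suc)
  where
  inner : Fin m → Fin m → ℕ
  inner a b = sumFin m (λ c → if a <F b ∧ b <F c then f (F.suc a) (F.suc b) (F.suc c) else 0)
  from-suc : ∀ a →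
    sumFin (suc m) (λ b → sumFin (suc m) (λ c → if F.suc a <F b ∧ b <F c then f (F.suc a) b c else 0))
    ≡ sumFin m (inner a)
  from-suc a =
    trans (cong (_+ sumFin m (λ b → sumFin (suc m) (λ c →
                   if F.suc a <F F.suc b ∧ F.suc b <F c then f (F.suc a) (F.suc b) c else 0))) (sumFin-0 (suc m)))
          (sumFin-cong (λ b → cong (_+ inner a b)
                         (cong (λ w → if w then f (F.suc a) (F.suc b) F.zero else 0) (Boolₚ.∧-zeroʳ (a <F b)))))

sumPairs-endpoints : ∀ m (h : Fin m → ℕ) → sumPairs m (λ u v → h u + h v) ≡ (m ∸ 1) * sumFin m h
sumPairs-endpoints zero          h = refl
sumPairs-endpoints (suc zero)    h = refl
sumPairs-endpoints (suc (suc m)) h = trans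
  (cong₂ _+_ (trans (sumFin-+ (suc m) (λ _ → h F.zero) (λ v → h (F.suc v)))
                    (cong (_+ H) (sumFin-const (suc m) (h F.zero))))
             (sumPairs-endpoints (suc m) (λ v → h (F.suc v))))
  (collect m (h F.zero) H)
  where
  H : ℕ
  H = sumFin (suc m) (λ v → h (F.suc v))
  collect : ∀ m h₀ H → suc m * h₀ + H + m * H ≡ suc m * (h₀ + H)
  collect = solve-∀

sumTriples-pairs : ∀ m (δ : Fin m → Fin m → ℕ) →
  sumTriples m (λ a b c → δ a b + δ a c + δ b c) ≡ (m ∸ 2) * sumPairs m δ
sumTriples-pairs zero                δ = refl
sumTriples-pairs (suc zero)          δ = refl
sumTriples-pairs (suc (suc zero))    δ = refl
sumTriples-pairs (suc (suc (suc m))) δ = begin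
  sumTriples (3 + m) (λ a b c → δ a b + δ a c + δ b c)
    ≡⟨ sumTriples-suc (2 + m) (λ a b c → δ a b + δ a c + δ b c) ⟩
  sumPairs (2 + m) (λ b c → δ₀ b + δ₀ c + δ' b c)
    + sumTriples (2 + m) (λ a b c → δ' a b + δ' a c + δ' b c)
    ≡⟨ cong₂ _+_ (sumPairs-+ (2 + m) (λ b c → δ₀ b + δ₀ c) δ') (sumTriples-pairs (suc (suc m)) δ') ⟩
  sumPairs (2 + m) (λ b c → δ₀ b + δ₀ c) + sumPairs (2 + m) δ' + m * sumPairs (2 + m) δ'
    ≡⟨ cong (λ z → z + sumPairs (2 + m) δ' + m * sumPairs (2 + m) δ') (sumPairs-endpoints (2 + m) δ₀) ⟩
  suc m * sumFin (2 + m) δ₀ + sumPairs (2 + m) δ' + m * sumPairs (2 + m) δ'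
    ≡⟨ collect m (sumFin (2 + m) δ₀) (sumPairs (2 + m) δ') ⟩
  suc m * sumPairs (3 + m) δ ∎
  where
  open ≡-Reasoning
  δ₀ : Fin (2 + m) → ℕ
  δ₀ b = δ F.zero (F.suc b)
  δ' : Fin (2 + m) → Fin (2 + m) → ℕ
  δ' a b = δ (F.suc a) (F.suc b)
  collect : ∀ m H X → suc m * H + X + m * X ≡ suc m * (H + X)
  collect = solve-∀

increasing : ∀ {q} → Fin q → Fin q → Fin q → Bool
increasing x y z = x <F y ∧ y <F z

distinct : ∀ {q} → Fin q → Fin q → Fin q → Bool
distinct x y z = not (x ≡ᵇ y) ∧ not (x ≡ᵇ z) ∧ not (y ≡ᵇ z)

orderings : ∀ {q} → Fin q → Fin q → Fin q → ℕ
orderings x y z = 𝟙 (increasing x y z) + 𝟙 (increasing x z y) + 𝟙 (increasing y x z)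
                + 𝟙 (increasing y z x) + 𝟙 (increasing z x y) + 𝟙 (increasing z y x)

𝟙-distinct≡orderings : ∀ {q} (x y z : Fin q) → 𝟙 (distinct x y z) ≡ orderings x y z
𝟙-distinct≡orderings x y z with x ≟ y
... | yes refl rewrite <F-irrefl x | <F-asym x z | Boolₚ.∧-zeroʳ (z <F x) = refl
... | no x≢y with x ≟ z
... | yes refl rewrite <F-irrefl x | <F-asym x y | Boolₚ.∧-zeroʳ (y <F x) = refl
... | no x≢z with y ≟ z
... | yes refl rewrite <F-irrefl y | <F-asym y x | Boolₚ.∧-zeroʳ (x <F y) = refl
... | no y≢z with <F-trichotomy x y | <F-trichotomy x z | <F-trichotomy y z
... | inj₂ (inj₁ x≡y) | _ | _ = ⊥-elim (x≢y x≡y)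
... | _ | inj₂ (inj₁ x≡z) | _ = ⊥-elim (x≢z x≡z)
... | _ | _ | inj₂ (inj₁ y≡z) = ⊥-elim (y≢z y≡z)
... | inj₁ (p₁ , q₁)        | inj₁ (p₂ , q₂)        | inj₁ (p₃ , q₃)        rewrite p₁ | q₁ | p₂ | q₂ | p₃ | q₃ = refl
... | inj₁ (p₁ , q₁)        | inj₁ (p₂ , q₂)        | inj₂ (inj₂ (p₃ , q₃)) rewrite p₁ | q₁ | p₂ | q₂ | p₃ | q₃ = refl
... | inj₁ (p₁ , _)         | inj₂ (inj₂ (p₂ , _))  | inj₁ (p₃ , _)         =
  ⊥-elim (≡true⇒≢false (<F-trans {x = x} {y = y} {z = z} p₁ p₃) p₂)
... | inj₁ (p₁ , q₁)        | inj₂ (inj₂ (p₂ , q₂)) | inj₂ (inj₂ (p₃ , q₃)) rewrite p₁ | q₁ | p₂ | q₂ | p₃ | q₃ = refl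
... | inj₂ (inj₂ (p₁ , q₁)) | inj₁ (p₂ , q₂)        | inj₁ (p₃ , q₃)        rewrite p₁ | q₁ | p₂ | q₂ | p₃ | q₃ = refl
... | inj₂ (inj₂ (_ , q₁))  | inj₁ (_ , q₂)         | inj₂ (inj₂ (_ , q₃))  =
  ⊥-elim (≡true⇒≢false (<F-trans {x = z} {y = y} {z = x} q₃ q₁) q₂)
... | inj₂ (inj₂ (p₁ , q₁)) | inj₂ (inj₂ (p₂ , q₂)) | inj₁ (p₃ , q₃)        rewrite p₁ | q₁ | p₂ | q₂ | p₃ | q₃ = refl
... | inj₂ (inj₂ (p₁ , q₁)) | inj₂ (inj₂ (p₂ , q₂)) | inj₂ (inj₂ (p₃ , q₃)) rewrite p₁ | q₁ | p₂ | q₂ | p₃ | q₃ = refl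

distinct-swap₁₂ : ∀ {q} (x y z : Fin q) → distinct x y z ≡ distinct y x z
distinct-swap₁₂ x y z rewrite ≡ᵇ-sym y x with not (x ≡ᵇ y)
... | true  = Boolₚ.∧-comm (not (x ≡ᵇ z)) (not (y ≡ᵇ z))
... | false = refl

distinct-swap₂₃ : ∀ {q} (x y z : Fin q) → distinct x y z ≡ distinct x z y
distinct-swap₂₃ x y z rewrite ≡ᵇ-sym z y with not (x ≡ᵇ y) | not (x ≡ᵇ z)
... | true  | true  = refl
... | true  | false = refl
... | false | true  = refl
... | false | false = refl

distinct-map : ∀ {n q} (f : Fin n → Fin q) (a b c : Fin n) →
               distinct (f a) (f b) (f c) ≡ true → distinct a b c ≡ true
distinct-map f a b c e with ∧-elim {not (f a ≡ᵇ f b)} e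
... | p₁ , p₂₃ with ∧-elim {not (f a ≡ᵇ f c)} p₂₃
...   | p₂ , p₃
  rewrite ≢⇒≡ᵇ-false {x = a} {y = b} (λ q → ≡ᵇ-false⇒≢ (not-true p₁) (cong f q))
        | ≢⇒≡ᵇ-false {x = a} {y = c} (λ q → ≡ᵇ-false⇒≢ (not-true p₂) (cong f q))
        | ≢⇒≡ᵇ-false {x = b} {y = c} (λ q → ≡ᵇ-false⇒≢ (not-true p₃) (cong f q)) = refl

sum³ : ∀ m → (Fin m → Fin m → Fin m → ℕ) → ℕ
sum³ m f = sumFin m λ a → sumFin m λ b → sumFin m λ c → f a b c

sum³-cong : ∀ m {f g : Fin m → Fin m → Fin m → ℕ} → (∀ a b c → f a b c ≡ g a b c) →
            sum³ m f ≡ sum³ m g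
sum³-cong m f≡g = sumFin-cong (λ a → sumFin-cong (λ b → sumFin-cong (f≡g a b)))

sum³-+ : ∀ m (f g : Fin m → Fin m → Fin m → ℕ) →
         sum³ m (λ a b c → f a b c + g a b c) ≡ sum³ m f + sum³ m g
sum³-+ m f g =
  trans (sumFin-cong (λ a → trans (sumFin-cong (λ b → sumFin-+ m (f a b) (g a b))) (sumFin-+ m _ _)))
        (sumFin-+ m _ _)

sum³-swap₂₃ : ∀ m (f : Fin m → Fin m → Fin m → ℕ) → sum³ m (λ a b c → f a c b) ≡ sum³ m f
sum³-swap₂₃ m f = sumFin-cong (λ a → sumFin-comm m m (λ b c → f a c b))

sum³-swap₁₂ : ∀ m (f : Fin m → Fin m → Fin m → ℕ) → sum³ m (λ a b c → f b a c) ≡ sum³ m f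
sum³-swap₁₂ m f = sumFin-comm m m (λ a b → sumFin m (f b a))

sum³-+₆ : ∀ m (f₁ f₂ f₃ f₄ f₅ f₆ : Fin m → Fin m → Fin m → ℕ) →
  sum³ m (λ a b c → f₁ a b c + f₂ a b c + f₃ a b c + f₄ a b c + f₅ a b c + f₆ a b c)
  ≡ sum³ m f₁ + sum³ m f₂ + sum³ m f₃ + sum³ m f₄ + sum³ m f₅ + sum³ m f₆
sum³-+₆ m f₁ f₂ f₃ f₄ f₅ f₆ =
  trans (sum³-+ m (λ a b c → f₁ a b c + f₂ a b c + f₃ a b c + f₄ a b c + f₅ a b c) f₆) (cong (_+ sum³ m f₆)
  (trans (sum³-+ m (λ a b c → f₁ a b c + f₂ a b c + f₃ a b c + f₄ a b c) f₅) (cong (_+ sum³ m f₅)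
  (trans (sum³-+ m (λ a b c → f₁ a b c + f₂ a b c + f₃ a b c) f₄) (cong (_+ sum³ m f₄)
  (trans (sum³-+ m (λ a b c → f₁ a b c + f₂ a b c) f₃) (cong (_+ sum³ m f₃)
  (sum³-+ m f₁ f₂))))))))

sum³-permutations : ∀ m (f : Fin m → Fin m → Fin m → ℕ) →
  sum³ m (λ a b c → f a b c + f a c b + f b a c + f b c a + f c a b + f c b a) ≡ 6 * sum³ m f
sum³-permutations m f = begin
  sum³ m (λ a b c → f a b c + f a c b + f b a c + f b c a + f c a b + f c b a)
    ≡⟨ sum³-+₆ m f (λ a b c → f a c b) (λ a b c → f b a c) (λ a b c → f b c a)
                   (λ a b c → f c a b) (λ a b c → f c b a) ⟩
  X + sum³ m (λ a b c → f a c b) + sum³ m (λ a b c → f b a c) + sum³ m (λ a b c → f b c a)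
    + sum³ m (λ a b c → f c a b) + sum³ m (λ a b c → f c b a)
    ≡⟨ cong₂ _+_ (cong₂ _+_ (cong₂ _+_ (cong₂ _+_ (cong (X +_) acb) bac) bca) cab) cba ⟩
  X + X + X + X + X + X
    ≡⟨ six-times X ⟩
  6 * X ∎
  where
  open ≡-Reasoning
  X : ℕ
  X = sum³ m f
  acb : sum³ m (λ a b c → f a c b) ≡ X
  acb = sum³-swap₂₃ m f
  bac : sum³ m (λ a b c → f b a c) ≡ X
  bac = sum³-swap₁₂ m f
  bca : sum³ m (λ a b c → f b c a) ≡ X
  bca = trans (sum³-swap₁₂ m (λ a b c → f a c b)) acb
  cab : sum³ m (λ a b c → f c a b) ≡ X
  cab = trans (sum³-swap₂₃ m (λ a b c → f b a c)) bac
  cba : sum³ m (λ a b c → f c b a) ≡ X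
  cba = trans (sum³-swap₂₃ m (λ a b c → f b c a)) bca
  six-times : ∀ X → X + X + X + X + X + X ≡ 6 * X
  six-times = solve-∀

sum³-symmetric : ∀ m (f : Fin m → Fin m → Fin m → ℕ) →
  (∀ a b c → f a b c ≡ f b a c) → (∀ a b c → f a b c ≡ f a c b) →
  (∀ a b c → f a b c ≡ 𝟙 (distinct a b c) * f a b c) → sum³ m f ≡ 6 * sumTriples m f
sum³-symmetric m f f₁₂ f₂₃ f-distinct = begin
  sum³ m f
    ≡⟨ sum³-cong m (λ a b c → trans (f-distinct a b c)
                                     (cong (_* f a b c) (𝟙-distinct≡orderings a b c))) ⟩
  sum³ m (λ a b c → orderings a b c * f a b c)
    ≡⟨ sum³-cong m spread ⟩
  sum³ m (λ a b c → g a b c + g a c b + g b a c + g b c a + g c a b + g c b a)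
    ≡⟨ sum³-permutations m g ⟩
  6 * sum³ m g
    ≡⟨ cong (6 *_) (sum³-cong m (λ a b c → ≡-sym (if-then-0≡𝟙* (increasing a b c) (f a b c)))) ⟩
  6 * sumTriples m f ∎
  where
  open ≡-Reasoning
  g : Fin m → Fin m → Fin m → ℕ
  g a b c = 𝟙 (increasing a b c) * f a b c
  distrib : ∀ i₁ i₂ i₃ i₄ i₅ i₆ F → (i₁ + i₂ + i₃ + i₄ + i₅ + i₆) * F
          ≡ i₁ * F + i₂ * F + i₃ * F + i₄ * F + i₅ * F + i₆ * F
  distrib = solve-∀
  spread : ∀ a b c → orderings a b c * f a b c ≡ g a b c + g a c b + g b a c + g b c a + g c a b + g c b a
  spread a b c = trans (distrib (𝟙 (increasing a b c)) (𝟙 (increasing a c b)) (𝟙 (increasing b a c))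
                                (𝟙 (increasing b c a)) (𝟙 (increasing c a b)) (𝟙 (increasing c b a)) (f a b c))
    (cong₂ _+_ (cong₂ _+_ (cong₂ _+_ (cong₂ _+_ (cong₂ _+_ refl
      (cong (𝟙 (increasing a c b) *_) (f₂₃ a b c)))
      (cong (𝟙 (increasing b a c) *_) (f₁₂ a b c)))
      (cong (𝟙 (increasing b c a) *_) (trans (f₁₂ a b c) (f₂₃ b a c))))
      (cong (𝟙 (increasing c a b) *_) (trans (f₂₃ a b c) (f₁₂ a c b))))
      (cong (𝟙 (increasing c b a) *_) (trans (f₁₂ a b c) (trans (f₂₃ b a c) (f₁₂ b c a)))))

module ComponentTriples {n q : ℕ} (c : Fin n → Fin q) where

  size : Fin q → ℕ
  size = compSize n q c

  sumFin-size : ∀ (g : Fin q → ℕ) → sumFin q (λ j → size j * g j) ≡ sumFin n (λ u → g (c u))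
  sumFin-size g = begin
    sumFin q (λ j → size j * g j)
      ≡⟨ sumFin-cong (λ j → trans (*-comm (size j) (g j)) (≡-sym (sumFin-*ˡ n (g j) _))) ⟩
    sumFin q (λ j → sumFin n (λ u → g j * (if c u ≡ᵇ j then 1 else 0)))
      ≡⟨ sumFin-comm q n _ ⟩
    sumFin n (λ u → sumFin q (λ j → g j * (if c u ≡ᵇ j then 1 else 0)))
      ≡⟨ sumFin-cong (λ u → trans (sumFin-cong (select u)) (sumFin-δ q (c u) g)) ⟩
    sumFin n (λ u → g (c u)) ∎
    where
    open ≡-Reasoning
    select : ∀ u j → g j * (if c u ≡ᵇ j then 1 else 0) ≡ (if c u ≡ᵇ j then g j else 0)
    select u j with c u ≡ᵇ j
    ... | true  = *-identityʳ (g j)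
    ... | false = *-zeroʳ (g j)

  N3≡sum³ : N3 n q c ≡ sum³ n (λ a b c' → 𝟙 (increasing (c a) (c b) (c c')))
  N3≡sum³ = begin
    N3 n q c
      ≡⟨ sum³-cong q (λ i j k → trans (if-then-0≡𝟙* (increasing i j k) _)
                                       (regroup (I i j k) (size i) (size j) (size k))) ⟩
    sum³ q (λ i j k → size i * (size j * (size k * I i j k)))
      ≡⟨ sumFin-cong (λ i → trans (sumFin-cong (λ j → sumFin-*ˡ q (size i) (λ k → size j * (size k * I i j k))))
                                  (sumFin-*ˡ q (size i) (λ j → sumFin q (λ k → size j * (size k * I i j k))))) ⟩
    sumFin q (λ i → size i * sumFin q (λ j → sumFin q (λ k → size j * (size k * I i j k))))
      ≡⟨ sumFin-cong (λ i → cong (size i *_) (sumFin-cong (λ j → sumFin-*ˡ q (size j) (λ k → size k * I i j k)))) ⟩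
    sumFin q (λ i → size i * sumFin q (λ j → size j * sumFin q (λ k → size k * I i j k)))
      ≡⟨ sumFin-cong (λ i → cong (size i *_) (sumFin-cong (λ j → cong (size j *_) (sumFin-size (I i j))))) ⟩
    sumFin q (λ i → size i * sumFin q (λ j → size j * sumFin n (λ c' → I i j (c c'))))
      ≡⟨ sumFin-cong (λ i → cong (size i *_) (sumFin-size (λ j → sumFin n (λ c' → I i j (c c'))))) ⟩
    sumFin q (λ i → size i * sumFin n (λ b → sumFin n (λ c' → I i (c b) (c c'))))
      ≡⟨ sumFin-size (λ i → sumFin n (λ b → sumFin n (λ c' → I i (c b) (c c')))) ⟩
    sum³ n (λ a b c' → I (c a) (c b) (c c')) ∎
    where
    open ≡-Reasoning
    I : Fin q → Fin q → Fin q → ℕ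
    I i j k = 𝟙 (increasing i j k)
    regroup : ∀ o a b d → o * (a * b * d) ≡ a * (b * (d * o))
    regroup = solve-∀

  distinctLabels : Fin n → Fin n → Fin n → ℕ
  distinctLabels a b c' = 𝟙 (distinct (c a) (c b) (c c'))

  sumTriples-distinctLabels≡N3 : sumTriples n distinctLabels ≡ N3 n q c
  sumTriples-distinctLabels≡N3 = *-cancelˡ-≡ _ _ 6 (begin
    6 * sumTriples n distinctLabels
      ≡⟨ ≡-sym (sum³-symmetric n distinctLabels
                  (λ a b c' → cong 𝟙 (distinct-swap₁₂ (c a) (c b) (c c')))
                  (λ a b c' → cong 𝟙 (distinct-swap₂₃ (c a) (c b) (c c')))
                  vanishes) ⟩
    sum³ n distinctLabels
      ≡⟨ sum³-cong n (λ a b c' → 𝟙-distinct≡orderings (c a) (c b) (c c')) ⟩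
    sum³ n (λ a b c' → orderings (c a) (c b) (c c'))
      ≡⟨ sum³-permutations n (λ a b c' → 𝟙 (increasing (c a) (c b) (c c'))) ⟩
    6 * sum³ n (λ a b c' → 𝟙 (increasing (c a) (c b) (c c')))
      ≡⟨ cong (6 *_) (≡-sym N3≡sum³) ⟩
    6 * N3 n q c ∎)
    where
    open ≡-Reasoning
    vanishes : ∀ a b c' → distinctLabels a b c' ≡ 𝟙 (distinct a b c') * distinctLabels a b c'
    vanishes a b c' with distinct a b c' in d
    ... | true  = ≡-sym (+-identityʳ _)
    ... | false with distinct (c a) (c b) (c c') in dc
    ...   | false = refl
    ...   | true  = ⊥-elim (≡true⇒≢false (distinct-map c a b c' dc) d)

-- Distances and Steiner distances in block graphs

module BlockGraph {n : ℕ} (G : Graph n) (G-blocks : IsBlockGraph G)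
  {t : ℕ} {B : Fin t → VSet n} (B-enum : BlockEnumeration G t B)
  {p : Fin t → ℕ} {c : (i : Fin t) → Fin n → Fin (p i)}
  (c-labels : ∀ i → IsComponentLabeling (deleteBlockEdges G (B i)) (p i) (c i)) where

  open Blocks G

  B-block : ∀ i → IsBlock G (B i)
  B-block = proj₁ B-enum

  B-injective : ∀ {i j} → B i ≗ B j → i ≡ j
  B-injective = proj₂ (proj₂ B-enum) _ _

  same : Fin t → ERel n
  same i u v = c i u ≡ᵇ c i v

  same⇒≡ : ∀ i {u v} → same i u v ≡ true → c i u ≡ c i v
  same⇒≡ i = ≡ᵇ⇒≡

  same-refl : ∀ i u → same i u u ≡ true
  same-refl i u = ≡ᵇ-refl (c i u)

  same-sym : ∀ i u v → same i u v ≡ same i v u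
  same-sym i u v = ≡ᵇ-sym (c i u) (c i v)

  same-trans : ∀ i {u v w} → same i u v ≡ true → same i v w ≡ true → same i u w ≡ true
  same-trans i {u} p q = subst (λ z → (c i u ≡ᵇ z) ≡ true) (same⇒≡ i q) p

  same-euclidean-⊥ : ∀ i {x y z} → same i x y ≡ true → same i x z ≡ true → same i y z ≡ false → ⊥
  same-euclidean-⊥ i {x} {y} sxy sxz syz =
    ≡true⇒≢false (same-trans i (trans (same-sym i y x) sxy) sxz) syz

  separated⇒≢ : ∀ i {x y} → same i x y ≡ false → x ≢ y
  separated⇒≢ i {x} s refl = ≡true⇒≢false (same-refl i x) s

  Reach⇒same : ∀ i {u v} → Reach (G∖ B i) u v → same i u v ≡ true
  Reach⇒same i {u} {v} r rewrite Equivalence.from (proj₂ (c-labels i) u v) r = ≡ᵇ-refl (c i v)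

  same⇒Reach : ∀ i {u v} → same i u v ≡ true → Reach (G∖ B i) u v
  same⇒Reach i {u} {v} s = Equivalence.to (proj₂ (c-labels i) u v) (≡ᵇ⇒≡ s)

  separated⇒∈B : ∀ i {u v} → adj G u v ≡ true → same i u v ≡ false → B i u ≡ true × B i v ≡ true
  separated⇒∈B i {u} {v} e s with B i u in bu | B i v in bv
  ... | true  | true  = refl , refl
  ... | false | _     = ⊥-elim (≡true⇒≢false (Reach⇒same i (1 , step kept here)) s)
    where kept : (G∖ B i) u v ≡ true
          kept rewrite e | bu = refl
  ... | true  | false = ⊥-elim (≡true⇒≢false (Reach⇒same i (1 , step kept here)) s)
    where kept : (G∖ B i) u v ≡ true
          kept rewrite e | bu | bv = refl

  -- The block containing the edge exists only under double negation, but the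
  -- separating index can then be found by a decidable search over Fin t.
  edge-separated : ∀ {u v} → adj G u v ≡ true → ∃[ i ] same i u v ≡ false
  edge-separated {u} {v} e with any? (λ i → same i u v Boolₚ.≟ false)
  ... | yes found = found
  ... | no none   = ⊥-elim (edge⊆block e λ { (C , C-block , cu , cv) → separates C C-block cu cv })
    where
    separates : ∀ C → IsBlock G C → C u ≡ true → C v ≡ true → ⊥
    separates C C-block cu cv with proj₁ (proj₂ B-enum) C C-block
    ... | i , Bi≗C with same i u v in s
    ...   | false = none (i , s)
    ...   | true with same⇒Reach i s
    ...     | k , W = noBypass (B-block i) (trans (Bi≗C u) cu) (trans (Bi≗C v) cv) (adj⇒≢ e) k W

  separating-block-unique : ∀ {u v} i j → adj G u v ≡ true →
                            same i u v ≡ false → same j u v ≡ false → i ≡ j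
  separating-block-unique i j e si sj with separated⇒∈B i e si | separated⇒∈B j e sj
  ... | biu , biv | bju , bjv =
    B-injective (blocks-share-two⇒≗ (B-block i) (B-block j) (adj⇒≢ e) biu biv bju bjv)

  block-separates : ∀ i {x y} → B i x ≡ true → B i y ≡ true → x ≢ y → same i x y ≡ false
  block-separates i {x} {y} bx by x≢y with G-blocks (B i) (B-block i) x y bx by x≢y
  ... | e with edge-separated e
  ...   | j , sj with separated⇒∈B j e sj
  ...     | bjx , bjy with B-injective (blocks-share-two⇒≗ (B-block i) (B-block j) x≢y bx by bjx bjy)
  ...       | refl = sj

  c-injective-on-B : ∀ i {x y} → B i x ≡ true → B i y ≡ true → c i x ≡ c i y → x ≡ y
  c-injective-on-B i {x} {y} bx by cx≡cy with x ≟ y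
  ... | yes x≡y = x≡y
  ... | no x≢y  = ⊥-elim (≡ᵇ-false⇒≢ (block-separates i bx by x≢y) cx≡cy)

  separations : Fin n → Fin n → ℕ
  separations u v = sumFin t (λ i → 𝟙 (not (same i u v)))

  edge-separations≡1 : ∀ {u v} → adj G u v ≡ true → separations u v ≡ 1
  edge-separations≡1 {u} {v} e with edge-separated e
  ... | i₀ , s₀ = trans (sumFin-cong only-i₀) (sumFin-δ t i₀ (λ _ → 1))
    where
    only-i₀ : ∀ i → 𝟙 (not (same i u v)) ≡ (if i₀ ≡ᵇ i then 1 else 0)
    only-i₀ i with i₀ ≟ i
    ... | yes refl rewrite s₀ = refl
    ... | no i₀≢i with same i u v in s
    ...   | true  = refl
    ...   | false = ⊥-elim (i₀≢i (separating-block-unique i₀ i e s₀ s))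

  crossings : Fin t → ∀ {u v k} → Walk (adj G) u v k → ℕ
  crossings i here                 = 0
  crossings i (step {u} {w} e W) = 𝟙 (not (same i u w)) + crossings i W

  sum-crossings≡length : ∀ {u v k} (W : Walk (adj G) u v k) → sumFin t (λ i → crossings i W) ≡ k
  sum-crossings≡length here = sumFin-0 t
  sum-crossings≡length (step {u} {w} e W) =
    trans (sumFin-+ t (λ i → 𝟙 (not (same i u w))) (λ i → crossings i W))
          (cong₂ _+_ (edge-separations≡1 e) (sum-crossings≡length W))

  crossings≡0⇒same : ∀ i {u v k} (W : Walk (adj G) u v k) → crossings i W ≡ 0 → c i u ≡ c i v
  crossings≡0⇒same i here               _ = refl
  crossings≡0⇒same i (step {u} {w} e W) z =
    trans (same⇒≡ i (𝟙-not≡0 (m+n≡0⇒m≡0 (𝟙 (not (same i u w))) z)))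
          (crossings≡0⇒same i W (m+n≡0⇒n≡0 (𝟙 (not (same i u w))) z))
    where
    𝟙-not≡0 : ∀ {b} → 𝟙 (not b) ≡ 0 → b ≡ true
    𝟙-not≡0 {true} _ = refl

  crossings≡1⇒separated : ∀ i {u v k} (W : Walk (adj G) u v k) → crossings i W ≡ 1 → c i u ≢ c i v
  crossings≡1⇒separated i (step {u} {w} e W) once with same i u w in s
  ... | true  = λ q → crossings≡1⇒separated i W once (trans (≡-sym (same⇒≡ i s)) q)
  ... | false = λ q → ≡ᵇ-false⇒≢ s (trans q (≡-sym (crossings≡0⇒same i W (suc-injective once))))

  record FirstCrossing (i : Fin t) (v : Fin n) (k : ℕ) : Set where
    field
      {x y}     : Fin n
      {k'}      : ℕ
      edge      : adj G x y ≡ true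
      separates : same i x y ≡ false
      after     : Walk (adj G) y v k'
      shorter   : k' < k

  firstCrossing : ∀ i {u v k} (W : Walk (adj G) u v k) → 1 ≤ crossings i W → FirstCrossing i v k
  firstCrossing i {v = v} (step {u} {w} {k = k} e W) crosses with same i u w in s
  ... | false = record { edge = e ; separates = s ; after = W ; shorter = n<1+n _ }
  ... | true  = record { edge = FirstCrossing.edge fc ; separates = FirstCrossing.separates fc
                       ; after = FirstCrossing.after fc ; shorter = m<n⇒m<1+n (FirstCrossing.shorter fc) }
    where
    fc : FirstCrossing i v k
    fc = firstCrossing i W crosses

  -- Between two crossings of the clique B i the walk can be replaced by one edge of B i.
  twoCrossings⇒shorter : ∀ i {u v k} (W : Walk (adj G) u v k) → 2 ≤ crossings i W →
                         ∃[ k' ] k' < k × Walk (adj G) u v k'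
  twoCrossings⇒shorter i (step {u} {w} e W) twice with same i u w in s
  ... | true with twoCrossings⇒shorter i W twice
  ...   | k' , k'<k , W' = suc k' , s≤s k'<k , step e W'
  twoCrossings⇒shorter i (step {u} {w} e W) twice | false
    with firstCrossing i W (s≤s⁻¹ twice)
  ... | fc with proj₁ (separated⇒∈B i e s)
             | proj₂ (separated⇒∈B i (FirstCrossing.edge fc) (FirstCrossing.separates fc))
  ...   | bu | by with u ≟ FirstCrossing.y fc
  ...     | yes refl = _ , m<n⇒m<1+n (FirstCrossing.shorter fc) , FirstCrossing.after fc
  ...     | no u≢y   = _ , s≤s (FirstCrossing.shorter fc)
                         , step (G-blocks (B i) (B-block i) u _ bu by u≢y) (FirstCrossing.after fc)

  module Geodesics (d : Fin n → Fin n → ℕ) (d-dist : IsDistance G d) where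

    geodesic : ∀ u v → Walk (adj G) u v (d u v)
    geodesic u v = proj₁ (d-dist u v)

    geodesic-crossings≤1 : ∀ i u v → crossings i (geodesic u v) ≤ 1
    geodesic-crossings≤1 i u v with crossings i (geodesic u v) in cw
    ... | zero        = z≤n
    ... | suc zero    = s≤s z≤n
    ... | suc (suc _) with twoCrossings⇒shorter i (geodesic u v) (subst (2 ≤_) (≡-sym cw) (s≤s (s≤s z≤n)))
    ...   | k' , k'<d , W' = ⊥-elim (<⇒≱ k'<d (proj₂ (d-dist u v) k' W'))

    geodesic-crossings : ∀ i u v → crossings i (geodesic u v) ≡ 𝟙 (not (same i u v))
    geodesic-crossings i u v
      with crossings i (geodesic u v) in cw | geodesic-crossings≤1 i u v | same i u v in s
    ... | zero        | _ | true  = refl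
    ... | zero        | _ | false = ⊥-elim (≡ᵇ-false⇒≢ s (crossings≡0⇒same i (geodesic u v) cw))
    ... | suc zero    | _ | false = refl
    ... | suc zero    | _ | true  = ⊥-elim (crossings≡1⇒separated i (geodesic u v) cw (same⇒≡ i s))
    ... | suc (suc _) | s≤s () | _

    d≡separations : ∀ u v → d u v ≡ separations u v
    d≡separations u v =
      trans (≡-sym (sum-crossings≡length (geodesic u v))) (sumFin-cong (λ i → geodesic-crossings i u v))

  crossing : Fin t → ERel n → ERel n
  crossing i Es u v = Es u v ∧ not (same i u v)

  #pairs≡sum-crossing : (Es : ERel n) → Es ⊆E adj G →
                        #pairs Es ≡ sumFin t (λ i → #pairs (crossing i Es))
  #pairs≡sum-crossing Es Es⊆G =
    trans (sumFin-cong (λ u → trans (sumFin-cong (split u)) (sumFin-comm n t _))) (sumFin-comm n t _)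
    where
    split : ∀ u v → 𝟙 (Es u v) ≡ sumFin t (λ i → 𝟙 (crossing i Es u v))
    split u v with Es u v in e
    ... | false = ≡-sym (sumFin-0 t)
    ... | true  = ≡-sym (edge-separations≡1 (Es⊆G u v e))

  2*edgeCount≡sum-crossing : (Es : ERel n) → Es ⊆E adj G →
    IsSymmetric Es → 2 * edgeCount n Es ≡ sumFin t (λ i → #pairs (crossing i Es))
  2*edgeCount≡sum-crossing Es Es⊆G Es-sym =
    trans (2*edgeCount≡#pairs Es Es-sym Es-irrefl) (#pairs≡sum-crossing Es Es⊆G)
    where
    Es-irrefl : ∀ u → Es u u ≡ false
    Es-irrefl u with Es u u in e
    ... | false = refl
    ... | true  = ⊥-elim (adj⇒≢ (Es⊆G u u e) refl)

  -- Twice the number of edges of B i needed to join a, b, c, read off from which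
  -- pairs among them lie in the same component of G ∖ B i.
  steinerCost : Bool → Bool → Bool → ℕ
  steinerCost ab ac bc = 𝟙 (not ab) + 𝟙 (not ac) + 𝟙 (not bc) + 𝟙 (not ab ∧ not ac ∧ not bc)

  distinctComponents : Fin t → Fin n → Fin n → Fin n → ℕ
  distinctComponents i = ComponentTriples.distinctLabels (c i)

  sum-steinerCost : ∀ a b c' → sumFin t (λ i → steinerCost (same i a b) (same i a c') (same i b c'))
    ≡ separations a b + separations a c' + separations b c' + sumFin t (λ i → distinctComponents i a b c')
  sum-steinerCost a b c' = begin
    sumFin t (λ i → sep i a b + sep i a c' + sep i b c' + distinctComponents i a b c')
      ≡⟨ sumFin-+ t (λ i → sep i a b + sep i a c' + sep i b c') (λ i → distinctComponents i a b c') ⟩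
    sumFin t (λ i → sep i a b + sep i a c' + sep i b c') + sumFin t (λ i → distinctComponents i a b c')
      ≡⟨ cong (_+ sumFin t (λ i → distinctComponents i a b c'))
              (trans (sumFin-+ t (λ i → sep i a b + sep i a c') (λ i → sep i b c'))
                     (cong (_+ separations b c') (sumFin-+ t (λ i → sep i a b) (λ i → sep i a c')))) ⟩
    separations a b + separations a c' + separations b c' + sumFin t (λ i → distinctComponents i a b c') ∎
    where
    open ≡-Reasoning
    sep : Fin t → Fin n → Fin n → ℕ
    sep i u v = 𝟙 (not (same i u v))

  separatingEdge : ∀ i {E : ERel n} {u v k} → Walk E u v k → c i u ≢ c i v →
                   ∃[ x ] ∃[ y ] E x y ≡ true × same i x y ≡ false × c i x ≡ c i u
  separatingEdge i here                 cu≢cv = ⊥-elim (cu≢cv refl)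
  separatingEdge i (step {u} {w} e W) cu≢cv with same i u w in s
  ... | false = u , w , e , s , refl
  ... | true with separatingEdge i W (λ q → cu≢cv (trans (same⇒≡ i s) q))
  ...   | x , y , exy , sxy , cx = x , y , exy , sxy , trans cx (≡-sym (same⇒≡ i s))

  module LowerBound (i : Fin t) {Vs : VSet n} {Es : ERel n} (Es-sym : IsSymmetric Es)
                    (Es-conn : ConnectedOn Es Vs) where

    crossing-sym : ∀ {u v} → crossing i Es u v ≡ true → BothWays (crossing i Es) u v
    crossing-sym {u} {v} p with ∧-elim {Es u v} p
    ... | euv , nsuv rewrite Es-sym v u | euv | same-sym i v u = p , nsuv

    leavingEdge : ∀ {a b} → Vs a ≡ true → Vs b ≡ true → same i a b ≡ false →
              ∃[ x ] ∃[ y ] crossing i Es x y ≡ true × c i x ≡ c i a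
    leavingEdge {a} {b} va vb s with Es-conn a b va vb
    ... | _ , W with separatingEdge i W (≡ᵇ-false⇒≢ s)
    ...   | x , y , exy , sxy , cx =
      x , y , restrict⇒edge exy sxy , cx
      where
      restrict⇒edge : restrict Es Vs x y ≡ true → same i x y ≡ false → crossing i Es x y ≡ true
      restrict⇒edge r sxy rewrite proj₁ (restrict-elim Es Vs x y r) | sxy = refl

    crossing⇒separated : ∀ {x y} → crossing i Es x y ≡ true → same i x y ≡ false
    crossing⇒separated {x} {y} p with same i x y
    ... | false = refl
    ... | true  = ⊥-elim (≡true⇒≢false p (Boolₚ.∧-zeroʳ (Es x y)))

    separated⇒2≤ : ∀ {a b} → Vs a ≡ true → Vs b ≡ true → same i a b ≡ false →
                   2 ≤ #pairs (crossing i Es)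
    separated⇒2≤ va vb s with leavingEdge va vb s
    ... | x , y , p , _ = #pairs≥2 (crossing i Es) (crossing-sym p) (separated⇒≢ i (crossing⇒separated p))

    two-crossings⇒4≤ : ∀ {x y x' y'} → crossing i Es x y ≡ true → crossing i Es x' y' ≡ true →
                        ¬ (x ≡ x' × y ≡ y') → ¬ (x ≡ y' × y ≡ x') → 4 ≤ #pairs (crossing i Es)
    two-crossings⇒4≤ p p' = #pairs≥4 (crossing i Es) (crossing-sym p) (crossing-sym p')
      (separated⇒≢ i (crossing⇒separated p)) (separated⇒≢ i (crossing⇒separated p'))

    -- The edges leaving the component of a towards b, that of b towards a, and that of c towards a
    -- start in three different components; two of them are distinct even as unordered edges.
    pairwiseSeparated⇒4≤ : ∀ {a b c'} → Vs a ≡ true → Vs b ≡ true → Vs c' ≡ true →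
           same i a b ≡ false → same i a c' ≡ false → same i b c' ≡ false → 4 ≤ #pairs (crossing i Es)
    pairwiseSeparated⇒4≤ {a} {b} {c'} va vb vc sab sac sbc
      with leavingEdge va vb sab | leavingEdge vb va (trans (same-sym i b a) sab)
         | leavingEdge vc va (trans (same-sym i c' a) sac)
    ... | x₁ , y₁ , p₁ , l₁ | x₂ , y₂ , p₂ , l₂ | x₃ , y₃ , p₃ , l₃ with x₁ ≟ y₂ | y₁ ≟ x₂
    ...   | yes _ | yes y₁≡x₂ = two-crossings⇒4≤ p₁ p₃
            (λ (x₁≡x₃ , _) → ≡ᵇ-false⇒≢ sac (trans (≡-sym l₁) (trans (cong (c i) x₁≡x₃) l₃)))
            (λ (_ , y₁≡x₃) → ≡ᵇ-false⇒≢ sbc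
                (trans (≡-sym l₂) (trans (cong (c i) (≡-sym y₁≡x₂)) (trans (cong (c i) y₁≡x₃) l₃))))
    ...   | yes _ | no y₁≢x₂ = two-crossings⇒4≤ p₁ p₂
            (λ (x₁≡x₂ , _) → ≡ᵇ-false⇒≢ sab (trans (≡-sym l₁) (trans (cong (c i) x₁≡x₂) l₂)))
            (λ (_ , y₁≡x₂) → y₁≢x₂ y₁≡x₂)
    ...   | no x₁≢y₂ | _ = two-crossings⇒4≤ p₁ p₂
            (λ (x₁≡x₂ , _) → ≡ᵇ-false⇒≢ sab (trans (≡-sym l₁) (trans (cong (c i) x₁≡x₂) l₂)))
            (λ (x₁≡y₂ , _) → x₁≢y₂ x₁≡y₂)

    lowerBound : ∀ {a b c'} → Vs a ≡ true → Vs b ≡ true → Vs c' ≡ true →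
                 steinerCost (same i a b) (same i a c') (same i b c') ≤ #pairs (crossing i Es)
    lowerBound {a} {b} {c'} va vb vc with same i a b in sab | same i a c' in sac | same i b c' in sbc
    ... | true  | true  | true  = z≤n
    ... | true  | true  | false = ⊥-elim (same-euclidean-⊥ i sab sac sbc)
    ... | true  | false | true  = ⊥-elim (same-euclidean-⊥ i (trans (same-sym i b a) sab) sbc sac)
    ... | false | true  | true  = ⊥-elim (same-euclidean-⊥ i (trans (same-sym i c' a) sac) (trans (same-sym i c' b) sbc) sab)
    ... | true  | false | false = separated⇒2≤ va vc sac
    ... | false | true  | false = separated⇒2≤ va vb sab
    ... | false | false | true  = separated⇒2≤ va vb sab
    ... | false | false | false = pairwiseSeparated⇒4≤ va vb vc sab sac sbc

  #crossing-edges≤crossings : ∀ i {s e k} (W : Walk (adj G) s e k) →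
                              #pairs (crossing i (edges W)) ≤ crossings i W
  #crossing-edges≤crossings i here = ≤-reflexive (sumFin-≡0 {n} (λ u → sumFin-0 n))
  #crossing-edges≤crossings i (step {u} {w} e W) = begin
    #pairs (crossing i (edges (step e W)))
      ≤⟨ sum²-mono-≤ (λ a b → 𝟙-∨∧ ((a ≡ᵇ u) ∧ (b ≡ᵇ w)) (edges W a b) (not (same i a b))) ⟩
    sum² (λ a b → 𝟙 (((a ≡ᵇ u) ∧ (b ≡ᵇ w)) ∧ not (same i a b)) + 𝟙 (crossing i (edges W) a b))
      ≡⟨ sum²-+ (λ a b → 𝟙 (((a ≡ᵇ u) ∧ (b ≡ᵇ w)) ∧ not (same i a b)))
                (λ a b → 𝟙 (crossing i (edges W) a b)) ⟩
    #pairs (λ a b → ((a ≡ᵇ u) ∧ (b ≡ᵇ w)) ∧ not (same i a b)) + #pairs (crossing i (edges W))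
      ≤⟨ +-mono-≤ (≤-reflexive (#pairs-at u w (λ a b → not (same i a b))))
                  (#crossing-edges≤crossings i W) ⟩
    crossings i (step e W) ∎
    where open ≤-Reasoning

  #crossing-reversed-edges : ∀ i {s e k} (W : Walk (adj G) s e k) →
    #pairs (λ a b → edges W b a ∧ not (same i a b)) ≡ #pairs (crossing i (edges W))
  #crossing-reversed-edges i W =
    trans (sum²-cong (λ a b → cong (λ z → 𝟙 (edges W b a ∧ not z)) (same-sym i a b)))
          (sum²-transpose (λ a b → 𝟙 (crossing i (edges W) a b)))

  crossing-edge⇒1≤crossings : ∀ i {s e k} (W : Walk (adj G) s e k) {x y} →
    edges W x y ≡ true → same i x y ≡ false → 1 ≤ crossings i W
  crossing-edge⇒1≤crossings i (step e W) q sxy with edges-step e W q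
  ... | inj₂ r             = ≤-trans (crossing-edge⇒1≤crossings i W r sxy) (m≤n+m _ _)
  ... | inj₁ (refl , refl) rewrite sxy = s≤s z≤n

  crossingEdge : ∀ i {s e k} (W : Walk (adj G) s e k) → 1 ≤ crossings i W →
                 ∃[ x ] ∃[ y ] edges W x y ≡ true × same i x y ≡ false
  crossingEdge i (step {u} {w} e W) crosses with same i u w in s
  ... | false = u , w , first-edge e W , s
  ... | true with crossingEdge i W crosses
  ...   | x , y , q , sxy = x , y , ∨-introʳ ((x ≡ᵇ u) ∧ (y ≡ᵇ w)) q , sxy

  crossingEdge-components : ∀ i {s e k} (W : Walk (adj G) s e k) → crossings i W ≤ 1 → ∀ {x y} →
    edges W x y ≡ true → same i x y ≡ false → c i x ≡ c i s × c i y ≡ c i e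
  crossingEdge-components i (step {u} {w} e W) ≤1 q sxy with same i u w in s | edges-step e W q
  ... | false | inj₂ r             = ⊥-elim (<⇒≱ (crossing-edge⇒1≤crossings i W r sxy) (s≤s⁻¹ ≤1))
  ... | false | inj₁ (refl , refl) = refl , crossings≡0⇒same i W (n≤0⇒n≡0 (s≤s⁻¹ ≤1))
  ... | true  | inj₁ (refl , refl) = ⊥-elim (≡true⇒≢false s sxy)
  ... | true  | inj₂ r with crossingEdge-components i W ≤1 r sxy
  ... | cx , cy = trans cx (≡-sym (same⇒≡ i s)) , cy

  module SteinerDistance (d : Fin n → Fin n → ℕ) (d-dist : IsDistance G d) where
    open Geodesics d d-dist

    module GeodesicUnion (a b c' : Fin n) where

      P : Walk (adj G) a b (d a b)
      P = geodesic a b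

      Q : Walk (adj G) a c' (d a c')
      Q = geodesic a c'

      Es : ERel n
      Es u v = edges P u v ∨ edges P v u ∨ edges Q u v ∨ edges Q v u

      Vs : VSet n
      Vs u = visits P u ∨ visits Q u

      Es-sym : IsSymmetric Es
      Es-sym u v = swap-pairs (edges P u v) (edges P v u) (edges Q u v) (edges Q v u)
        where
        swap-pairs : ∀ w x y z → (w ∨ x ∨ y ∨ z) ≡ (x ∨ w ∨ z ∨ y)
        swap-pairs true  true  _ _ = refl
        swap-pairs true  false _ _ = refl
        swap-pairs false true  _ _ = refl
        swap-pairs false false y z = Boolₚ.∨-comm y z

      Es-elim : ∀ u v → Es u v ≡ true → adj G u v ≡ true × Vs u ≡ true × Vs v ≡ true
      Es-elim u v q with ∨-elim {edges P u v} q
      ... | inj₁ r with edges-elim P u v r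
      ...   | e , pu , pv = e , ∨-introˡ _ pu , ∨-introˡ _ pv
      Es-elim u v q | inj₂ q₂ with ∨-elim {edges P v u} q₂
      ... | inj₁ r with edges-elim P v u r
      ...   | e , pv , pu = trans (adj-sym u v) e , ∨-introˡ _ pu , ∨-introˡ _ pv
      Es-elim u v q | inj₂ q₂ | inj₂ q₃ with ∨-elim {edges Q u v} q₃
      ... | inj₁ r with edges-elim Q u v r
      ...   | e , qu , qv = e , ∨-introʳ (visits P u) qu , ∨-introʳ (visits P v) qv
      Es-elim u v q | inj₂ q₂ | inj₂ q₃ | inj₂ r with edges-elim Q v u r
      ... | e , qv , qu = trans (adj-sym u v) e , ∨-introʳ (visits P u) qu , ∨-introʳ (visits P v) qv

      Es-connected : ConnectedOn Es Vs
      Es-connected y z vy vz = Reach-trans (Reach-sym (restrict-sym Es Vs Es-sym) (fromA y vy)) (fromA z vz)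
        where
        fromA : ∀ z → Vs z ≡ true → Reach (restrict Es Vs) a z
        fromA z q with ∨-elim {visits P z} q
        ... | inj₁ r = walk-spans Es Vs P (λ x y o → ∨-introˡ _ o) (λ z' o → ∨-introˡ _ o) z r
        ... | inj₂ r = walk-spans Es Vs Q
                         (λ x y o → ∨-introʳ (edges P x y) (∨-introʳ (edges P y x) (∨-introˡ _ o)))
                                          (λ z' o → ∨-introʳ (visits P z') o) z r

      spanning : IsConnectedSubgraph G Vs Es
      spanning = Es-elim , Es-sym , Es-connected

      a∈Vs : Vs a ≡ true
      a∈Vs = ∨-introˡ _ (visits-start P)

      b∈Vs : Vs b ≡ true
      b∈Vs = ∨-introˡ _ (visits-end P)

      c∈Vs : Vs c' ≡ true
      c∈Vs = ∨-introʳ (visits P c') (visits-end Q)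

      module _ (i : Fin t) where

        #P≤ : #pairs (crossing i (edges P)) ≤ 𝟙 (not (same i a b))
        #P≤ = ≤-trans (#crossing-edges≤crossings i P) (≤-reflexive (geodesic-crossings i a b))

        #Q≤ : #pairs (crossing i (edges Q)) ≤ 𝟙 (not (same i a c'))
        #Q≤ = ≤-trans (#crossing-edges≤crossings i Q) (≤-reflexive (geodesic-crossings i a c'))

        #reversed : ∀ {k} {x : Fin n} (W : Walk (adj G) a x k) → ℕ
        #reversed W = #pairs (λ u v → edges W v u ∧ not (same i u v))

        twoGeodesicsBound : ∀ {ab ac} → same i a b ≡ ab → same i a c' ≡ ac →
          #pairs (crossing i Es) ≤ 𝟙 (not ab) + (𝟙 (not ab) + (𝟙 (not ac) + 𝟙 (not ac)))
        twoGeodesicsBound refl refl = begin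
          #pairs (crossing i Es)
            ≤⟨ sum²-mono-≤ split ⟩
          sum² (λ u v → 𝟙 (crossing i (edges P) u v) + (𝟙 (edges P v u ∧ N u v)
                       + (𝟙 (crossing i (edges Q) u v) + 𝟙 (edges Q v u ∧ N u v))))
            ≡⟨ sum²-+ {n} _ _ ⟩
          #pairs (crossing i (edges P)) + sum² (λ u v → 𝟙 (edges P v u ∧ N u v)
                       + (𝟙 (crossing i (edges Q) u v) + 𝟙 (edges Q v u ∧ N u v)))
            ≡⟨ cong (#pairs (crossing i (edges P)) +_)
                    (trans (sum²-+ {n} _ _) (cong (#reversed P +_) (sum²-+ {n} _ _))) ⟩
          #pairs (crossing i (edges P)) + (#reversed P + (#pairs (crossing i (edges Q)) + #reversed Q))
            ≡⟨ cong₂ (λ x y → #pairs (crossing i (edges P)) + (x + (#pairs (crossing i (edges Q)) + y)))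
                     (#crossing-reversed-edges i P) (#crossing-reversed-edges i Q) ⟩
          #pairs (crossing i (edges P)) + (#pairs (crossing i (edges P))
                       + (#pairs (crossing i (edges Q)) + #pairs (crossing i (edges Q))))
            ≤⟨ +-mono-≤ #P≤ (+-mono-≤ #P≤ (+-mono-≤ #Q≤ #Q≤)) ⟩
          𝟙 (not (same i a b)) + (𝟙 (not (same i a b)) + (𝟙 (not (same i a c')) + 𝟙 (not (same i a c')))) ∎
          where
          open ≤-Reasoning
          N : ERel n
          N u v = not (same i u v)
          split : ∀ u v → 𝟙 (crossing i Es u v) ≤ 𝟙 (crossing i (edges P) u v) + (𝟙 (edges P v u ∧ N u v)
                       + (𝟙 (crossing i (edges Q) u v) + 𝟙 (edges Q v u ∧ N u v)))
          split u v = ≤-trans (𝟙-∨∧ (edges P u v) _ (N u v)) (+-monoʳ-≤ (𝟙 (crossing i (edges P) u v))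
                        (≤-trans (𝟙-∨∧ (edges P v u) _ (N u v)) (+-monoʳ-≤ (𝟙 (edges P v u ∧ N u v))
                          (𝟙-∨∧ (edges Q u v) (edges Q v u) (N u v)))))

        -- Both geodesics cross B i from the component of a to that of b and c, and the
        -- labelling c i is injective on B i, so they cross through the same edge.
        module _ (sab : same i a b ≡ false) (sbc : same i b c' ≡ true) where

          Q-crossing⇒P-edge : ∀ x y → edges Q x y ≡ true → same i x y ≡ false → edges P x y ≡ true
          Q-crossing⇒P-edge x y q sxy
            with crossingEdge-components i Q (geodesic-crossings≤1 i a c') q sxy
               | crossingEdge i P (≤-reflexive (≡-sym (trans (geodesic-crossings i a b)
                                                              (cong (λ z → 𝟙 (not z)) sab))))
          ... | cx , cy | x' , y' , p , sx'y' with crossingEdge-components i P (geodesic-crossings≤1 i a b) p sx'y'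
          ...   | cx' , cy' with separated⇒∈B i (proj₁ (edges-elim Q x y q)) sxy
                               | separated⇒∈B i (proj₁ (edges-elim P x' y' p)) sx'y'
          ...     | bx , by | bx' , by' =
            subst₂ (λ u v → edges P u v ≡ true)
                   (≡-sym (c-injective-on-B i bx bx' (trans cx (≡-sym cx'))))
                   (≡-sym (c-injective-on-B i by by' (trans cy (trans (≡-sym (same⇒≡ i sbc)) (≡-sym cy'))))) p

          sharedEdgeBound : #pairs (crossing i Es) ≤ 2
          sharedEdgeBound = begin
            #pairs (crossing i Es)                                  ≤⟨ sum²-mono-≤ onP ⟩
            sum² (λ u v → 𝟙 (crossing i (edges P) u v) + 𝟙 (edges P v u ∧ not (same i u v)))
              ≡⟨ sum²-+ {n} _ _ ⟩
            #pairs (crossing i (edges P)) + #reversed P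
              ≡⟨ cong (#pairs (crossing i (edges P)) +_) (#crossing-reversed-edges i P) ⟩
            #pairs (crossing i (edges P)) + #pairs (crossing i (edges P))
              ≤⟨ +-mono-≤ #P≤ #P≤ ⟩
            𝟙 (not (same i a b)) + 𝟙 (not (same i a b))          ≡⟨ cong (λ z → 𝟙 (not z) + 𝟙 (not z)) sab ⟩
            2                                                      ∎
            where
            open ≤-Reasoning
            𝟙≤-left : ∀ {x} y → x ≡ true → 1 ≤ 𝟙 x + 𝟙 y
            𝟙≤-left y refl = s≤s z≤n
            𝟙≤-right : ∀ x {y} → y ≡ true → 1 ≤ 𝟙 x + 𝟙 y
            𝟙≤-right x refl = m≤n+m 1 (𝟙 x)
            onP : ∀ u v → 𝟙 (crossing i Es u v)
                          ≤ 𝟙 (crossing i (edges P) u v) + 𝟙 (edges P v u ∧ not (same i u v))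
            onP u v with same i u v in suv
            ... | true rewrite Boolₚ.∧-zeroʳ (Es u v) = z≤n
            ... | false rewrite Boolₚ.∧-identityʳ (Es u v) | Boolₚ.∧-identityʳ (edges P u v)
                              | Boolₚ.∧-identityʳ (edges P v u) with Es u v in euv
            ...   | false = z≤n
            ...   | true with ∨-elim {edges P u v} euv
            ...     | inj₁ r = 𝟙≤-left (edges P v u) r
            ...     | inj₂ r₂ with ∨-elim {edges P v u} r₂
            ...       | inj₁ r = 𝟙≤-right (edges P u v) r
            ...       | inj₂ r₃ with ∨-elim {edges Q u v} r₃
            ...         | inj₁ r = 𝟙≤-left (edges P v u) (Q-crossing⇒P-edge u v r suv)
            ...         | inj₂ r =
              𝟙≤-right (edges P u v) (Q-crossing⇒P-edge v u r (trans (same-sym i v u) suv))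

        upperBound : #pairs (crossing i Es) ≤ steinerCost (same i a b) (same i a c') (same i b c')
        upperBound with same i a b in sab | same i a c' in sac | same i b c' in sbc
        ... | true  | true  | true  = twoGeodesicsBound sab sac
        ... | true  | false | false = twoGeodesicsBound sab sac
        ... | false | true  | false = twoGeodesicsBound sab sac
        ... | false | false | false = twoGeodesicsBound sab sac
        ... | false | false | true  = sharedEdgeBound sab sbc
        ... | true  | true  | false = ⊥-elim (same-euclidean-⊥ i sab sac sbc)
        ... | true  | false | true  = ⊥-elim (same-euclidean-⊥ i (trans (same-sym i b a) sab) sbc sac)
        ... | false | true  | true  = ⊥-elim (same-euclidean-⊥ i (trans (same-sym i c' a) sac) (trans (same-sym i c' b) sbc) sab)

    2*steiner≡sum-steinerCost : ∀ a b c' k → IsSteinerDist G a b c' k →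
      2 * k ≡ sumFin t (λ i → steinerCost (same i a b) (same i a c') (same i b c'))
    2*steiner≡sum-steinerCost a b c' k
      ((Vs , Es , (Es-elim , Es-sym , Es-conn) , va , vb , vc , |Es|≡k) , minimal) =
      ≤-antisym upper lower
      where
      module U = GeodesicUnion a b c'
      lower : sumFin t (λ i → steinerCost (same i a b) (same i a c') (same i b c')) ≤ 2 * k
      lower = begin
        sumFin t (λ i → steinerCost (same i a b) (same i a c') (same i b c'))
          ≤⟨ sumFin-mono-≤ (λ i → LowerBound.lowerBound i Es-sym Es-conn va vb vc) ⟩
        sumFin t (λ i → #pairs (crossing i Es))
          ≡⟨ ≡-sym (2*edgeCount≡sum-crossing Es (λ u v e → proj₁ (Es-elim u v e)) Es-sym) ⟩
        2 * edgeCount n Es                      ≡⟨ cong (2 *_) |Es|≡k ⟩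
        2 * k                                   ∎
        where open ≤-Reasoning
      upper : 2 * k ≤ sumFin t (λ i → steinerCost (same i a b) (same i a c') (same i b c'))
      upper = begin
        2 * k                                      ≤⟨ *-monoʳ-≤ 2 (minimal U.Vs U.Es U.spanning U.a∈Vs U.b∈Vs U.c∈Vs) ⟩
        2 * edgeCount n U.Es
          ≡⟨ 2*edgeCount≡sum-crossing U.Es (λ u v e → proj₁ (U.Es-elim u v e)) U.Es-sym ⟩
        sumFin t (λ i → #pairs (crossing i U.Es)) ≤⟨ sumFin-mono-≤ U.upperBound ⟩
        sumFin t (λ i → steinerCost (same i a b) (same i a c') (same i b c')) ∎
        where open ≤-Reasoning

    2*steiner≡separations+distinctComponents : ∀ a b c' k → IsSteinerDist G a b c' k →
      2 * k ≡ separations a b + separations a c' + separations b c' + sumFin t (λ i → distinctComponents i a b c')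
    2*steiner≡separations+distinctComponents a b c' k steiner =
      trans (2*steiner≡sum-steinerCost a b c' k steiner) (sum-steinerCost a b c')

    wiener≡sumPairs-separations : wiener n d ≡ sumPairs n separations
    wiener≡sumPairs-separations =
      sumFin-cong (λ u → sumFin-cong (λ v → cong (if u <F v then_else 0) (d≡separations u v)))

mainTheorem6 : (n : ℕ) (G : Graph n) → Connected G → IsBlockGraph G
    → (t : ℕ) (B : Fin t → VSet n) → BlockEnumeration G t B
    → (d : Fin n → Fin n → ℕ) → IsDistance G d
    → (sd : Fin n → Fin n → Fin n → ℕ) → IsSteinerDist3 G sd
    → (p : Fin t → ℕ) (c : (i : Fin t) → Fin n → Fin (p i))
    → (∀ i → IsComponentLabeling (deleteBlockEdges G (B i)) (p i) (c i))
    → 2 * steinerWiener3 n sd ≡ (n ∸ 2) * wiener n d + sumFin t (λ i → N3 n (p i) (c i))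
mainTheorem6 n G _ G-blocks t B B-enum d d-dist sd sd-steiner p c c-labels = begin
  2 * steinerWiener3 n sd
    ≡⟨ sumTriples-*ˡ n 2 sd ⟩
  sumTriples n (λ a b c' → 2 * sd a b c')
    ≡⟨ sumTriples-cong n (λ a b c' a<b b<c →
         2*steiner≡separations+distinctComponents a b c' (sd a b c') (sd-steiner a b c' a<b b<c)) ⟩
  sumTriples n (λ a b c' → separations a b + separations a c' + separations b c'
                           + sumFin t (λ i → distinctComponents i a b c'))
    ≡⟨ sumTriples-+ n _ _ ⟩
  sumTriples n (λ a b c' → separations a b + separations a c' + separations b c')
    + sumTriples n (λ a b c' → sumFin t (λ i → distinctComponents i a b c'))
    ≡⟨ cong₂ _+_ (sumTriples-pairs n separations) (sumTriples-sumFin n t distinctComponents) ⟩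
  (n ∸ 2) * sumPairs n separations + sumFin t (λ i → sumTriples n (distinctComponents i))
    ≡⟨ cong₂ _+_ (cong ((n ∸ 2) *_) (≡-sym wiener≡sumPairs-separations))
                 (sumFin-cong (λ i → ComponentTriples.sumTriples-distinctLabels≡N3 (c i))) ⟩
  (n ∸ 2) * wiener n d + sumFin t (λ i → N3 n (p i) (c i)) ∎
  where
  open ≡-Reasoning
  open BlockGraph G G-blocks B-enum c-labels
  open SteinerDistance d d-dist
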